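{- For all integers $n\ge 1$ and $k$, $$\mathfrak C_{2n}^{(k)}=\sum_{m=1}^n\sum_{l=1}^m\frac{(-4)^{n-m}}{(2m)!}\left[ {n \atop m} \right]_2\left[ {m \atop l} \right]_2\mathfrak B_{2l}^{(k)}.$$
   Context: The Stirling numbers of the first kind with level $2$, $\left[ {n \atop k} \right]_2$ ($n,k\ge0$), are defined by $\left[ {n \atop k} \right]_2=\left[ {n-1 \atop k-1} \right]_2+(n-1)^2\left[ {n-1 \atop k} \right]_2$ with $\left[ {0 \atop 0} \right]_2=1$ and $\left[ {n \atop 0} \right]_2=\left[ {0 \atop n} \right]_2=0$ for $n\ge1$ (equivalently $x(x+1^2)(x+2^2)\cdots(x+(n-1)^2)=\sum_{k}\left[ {n \atop k} \right]_2x^k$). For an integer $k$, the poly-Bernoulli numbers with level $2$ are defined by $\sum_{n\ge0}\mathfrak B_n^{(k)}\frac{x^n}{n!}=\frac{{\rm Li}_{2,k}(2\sin(x/2))}{2\sin(x/2)}$ with ${\rm Li}_{2,k}(z)=\sum_{n\ge0}\frac{z^{2n+1}}{(2n+1)^k}$, and the poly-Cauchy numbers with level $2$ are defined by $\sum_{n\ge0}\mathfrak C_n^{(k)}\frac{x^n}{n!}={\rm Lif}_{2,k}({\rm arcsinh}\,x)$ with ${\rm Lif}_{2,k}(z)=\sum_{m\ge0}\frac{z^{2m}}{(2m)!(2m+1)^k}$ (as power series). -}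

module Defs where

open import Data.Nat as ℕ using (ℕ; zero; suc; _!; _∸_)
open import Data.Nat.Properties using (m*n≢0; m^n≢0; _!≢0)
open import Data.Integer as ℤ using (ℤ; +_; -[1+_]; -1ℤ)
open import Data.Rational using (ℚ; _/_; _+_; _*_; 0ℚ; 1ℚ)

stirling1₂ : ℕ → ℕ → ℕ
stirling1₂ zero    zero    = 1
stirling1₂ zero    (suc k) = 0
stirling1₂ (suc n) zero    = 0
stirling1₂ (suc n) (suc k) = stirling1₂ n k ℕ.+ (n ℕ.* n) ℕ.* stirling1₂ n (suc k)

ℕ→ℚ : ℕ → ℚ
ℕ→ℚ n = + n / 1

ℤ→ℚ : ℤ → ℚ
ℤ→ℚ z = z / 1

Σ[0…_] : ℕ → (ℕ → ℚ) → ℚ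
Σ[0… zero  ] f = f 0
Σ[0… suc N ] f = Σ[0… N ] f + f (suc N)

Σ[1…_] : ℕ → (ℕ → ℚ) → ℚ
Σ[1… zero  ] f = 0ℚ
Σ[1… suc N ] f = Σ[1… N ] f + f (suc N)

Series : Set
Series = ℕ → ℚ

_⊛_ : Series → Series → Series
(f ⊛ g) N = Σ[0… N ] (λ i → f i * g (N ∸ i))

one : Series
one zero    = 1ℚ
one (suc _) = 0ℚ

_^ₛ_ : Series → ℕ → Series
f ^ₛ zero  = one
f ^ₛ suc p = f ⊛ (f ^ₛ p)

-- odd-only series Σ_j c j x^(2j+1)
oddSeries : (ℕ → ℚ) → Series
oddSeries c zero          = 0ℚ
oddSeries c (suc zero)    = c 0
oddSeries c (suc (suc N)) = oddSeries (λ j → c (suc j)) N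

oddPow⁻ : ℕ → ℤ → ℚ
oddPow⁻ n (+ m)     = (+ 1 / (suc (n ℕ.+ n) ℕ.^ m)) {{m^n≢0 (suc (n ℕ.+ n)) m}}
oddPow⁻ n -[1+ m ]  = ℕ→ℚ (suc (n ℕ.+ n) ℕ.^ suc m)

inv! : ℕ → ℚ
inv! n = (+ 1 / (n !)) {{n !≢0}}

-- 2 sin(x/2) = Σ_j (-1)^j x^(2j+1) / (4^j (2j+1)!)
twoSinHalf : Series
twoSinHalf = oddSeries (λ j → (ℤ→ℚ (-1ℤ ℤ.^ j) * (+ 1 / (4 ℕ.^ j)) {{m^n≢0 4 j}}) * inv! (suc (j ℕ.+ j)))

-- arcsinh x = Σ_j (-1)^j (2j)! x^(2j+1) / (4^j (j!)^2 (2j+1))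
arcsinh : Series
arcsinh = oddSeries (λ j → ℤ→ℚ (-1ℤ ℤ.^ j) * ℕ→ℚ ((j ℕ.+ j) !)
            * ((+ 1 / (4 ℕ.^ j)) {{m^n≢0 4 j}} * (inv! j * inv! j))
            * (+ 1 / suc (j ℕ.+ j)))

-- Poly-Bernoulli numbers with level 2:
-- Σ_N 𝔅_N^(k) x^N/N! = Li_{2,k}(2 sin(x/2)) / (2 sin(x/2)) = Σ_n (2 sin(x/2))^(2n) / (2n+1)^k.
-- Since (2 sin(x/2))^(2n) has order 2n, only n ≤ N contribute to x^N.
polyBernoulli₂ : ℕ → ℤ → ℚ
polyBernoulli₂ N k = ℕ→ℚ (N !) * Σ[0… N ] (λ n → (twoSinHalf ^ₛ (n ℕ.+ n)) N * oddPow⁻ n k)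

-- Poly-Cauchy numbers with level 2:
-- Σ_N ℭ_N^(k) x^N/N! = Lif_{2,k}(arcsinh x) = Σ_m (arcsinh x)^(2m) / ((2m)! (2m+1)^k).
polyCauchy₂ : ℕ → ℤ → ℚ
polyCauchy₂ N k = ℕ→ℚ (N !) * Σ[0… N ] (λ m → (arcsinh ^ₛ (m ℕ.+ m)) N * inv! (m ℕ.+ m) * oddPow⁻ m k)

-- Both z = 2 sin(x/2) and z = arcsinh x satisfy z(0) = 0, z′(0) = 1 and
-- (1 + γx²) z″ + γ x z′ = β z, with (γ, β) = (0, −1/4) and (1, 0) respectively, hence also the
-- first integral (1 + γx²) z′² = 1 + β z².  Differentiating z^p twice and using both identities
-- shows that T(l, j) = (2l)!/(2j)! · [x^{2l}] z^{2j} satisfies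
--   T(l+1, j+1) + γ (2l)² T(l, j+1) = T(l, j) + β (2j+2)² T(l, j+1).
-- For arcsinh this is the recurrence of (−4)^{l−j} [l, j]₂; for 2 sin(x/2) it is the recurrence
-- dual to that of [m, l]₂, so that Σ_l [m, l]₂ T(l, j) = δ_{mj}.  Since 𝔅_{2l} = Σ_j T(l, j) (2j)! / (2j+1)^k
-- and ℭ_{2n} = Σ_j (−4)^{n−j} [n, j]₂ / (2j+1)^k, the double sum of the theorem collapses to ℭ_{2n}.

module Submission where

open import Defs
open import Data.Nat as ℕ using (ℕ; zero; suc; _∸_; _!; _<_; _≤_; z≤n; s≤s)
import Data.Nat.Properties as ℕP
open import Data.Nat.Properties using (m*n≢0; m^n≢0; _!≢0)
open import Data.Integer as ℤ using (ℤ; -[1+_]; -1ℤ)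
open import Data.Rational as ℚ using (ℚ; _/_; _+_; _*_; -_; 0ℚ; 1ℚ; toℚᵘ)
open import Data.Rational.Properties
import Data.Rational.Unnormalised as ℚᵘ
import Data.Rational.Unnormalised.Properties as ℚᵘP
import Data.Integer.Properties as ℤP
open import Data.Product using (∃; _,_)
open import Data.Sum using (_⊎_; inj₁; inj₂)
open import Relation.Nullary using (contradiction)
open import Relation.Nullary.Decidable using (dec⇒maybe)
open import Function using (_∘_)
open import Relation.Binary.PropositionalEquality
open import Algebra.Bundles using (CommutativeSemiring)
open import Algebra.Properties.Group +-0-group using () renaming (∙-cancelʳ to +-cancelʳ)
import Relation.Binary.Reasoning.Setoid as SetoidReasoning
open import Tactic.RingSolver using (solve-∀)
open import Tactic.RingSolver.Core.AlmostCommutativeRing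
  using (AlmostCommutativeRing; fromCommutativeRing)
open import Level using (0ℓ)

ℚ-ring : AlmostCommutativeRing 0ℓ 0ℓ
ℚ-ring = fromCommutativeRing +-*-commutativeRing (λ x → dec⇒maybe (0ℚ ≟ x))

toℚᵘ-ℤ→ℚ : ∀ z → toℚᵘ (ℤ→ℚ z) ℚᵘ.≃ ℚᵘ.mkℚᵘ z 0
toℚᵘ-ℤ→ℚ z = toℚᵘ-fromℚᵘ (ℚᵘ.mkℚᵘ z 0)

ℤ→ℚ-+ : ∀ a b → ℤ→ℚ (a ℤ.+ b) ≡ ℤ→ℚ a + ℤ→ℚ b
ℤ→ℚ-+ a b = toℚᵘ-injective (ℚᵘP.≃-trans (toℚᵘ-ℤ→ℚ (a ℤ.+ b)) (ℚᵘP.≃-trans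
  (ℚᵘ.*≡* (cong (ℤ._* ℤ.+ 1) (cong₂ ℤ._+_ (sym (ℤP.*-identityʳ a)) (sym (ℤP.*-identityʳ b)))))
  (ℚᵘP.≃-sym (ℚᵘP.≃-trans (toℚᵘ-homo-+ (ℤ→ℚ a) (ℤ→ℚ b))
                          (ℚᵘP.+-cong (toℚᵘ-ℤ→ℚ a) (toℚᵘ-ℤ→ℚ b))))))

ℤ→ℚ-* : ∀ a b → ℤ→ℚ (a ℤ.* b) ≡ ℤ→ℚ a * ℤ→ℚ b
ℤ→ℚ-* a b = toℚᵘ-injective (ℚᵘP.≃-trans (toℚᵘ-ℤ→ℚ (a ℤ.* b))
  (ℚᵘP.≃-sym (ℚᵘP.≃-trans (toℚᵘ-homo-* (ℤ→ℚ a) (ℤ→ℚ b))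
                          (ℚᵘP.*-cong (toℚᵘ-ℤ→ℚ a) (toℚᵘ-ℤ→ℚ b)))))

ℕ→ℚ-+ : ∀ a b → ℕ→ℚ (a ℕ.+ b) ≡ ℕ→ℚ a + ℕ→ℚ b
ℕ→ℚ-+ a b = ℤ→ℚ-+ (ℤ.+ a) (ℤ.+ b)

ℕ→ℚ-* : ∀ a b → ℕ→ℚ (a ℕ.* b) ≡ ℕ→ℚ a * ℕ→ℚ b
ℕ→ℚ-* a b = trans (cong ℤ→ℚ (ℤP.pos-* a b)) (ℤ→ℚ-* (ℤ.+ a) (ℤ.+ b))

ℕ→ℚ-suc : ∀ n → ℕ→ℚ (suc n) ≡ 1ℚ + ℕ→ℚ n
ℕ→ℚ-suc = ℕ→ℚ-+ 1

1/n*n≡1 : ∀ n .{{_ : ℕ.NonZero n}} → (ℤ.+ 1 / n) * ℕ→ℚ n ≡ 1ℚ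
1/n*n≡1 (suc n) = toℚᵘ-injective (ℚᵘP.≃-trans (toℚᵘ-homo-* (ℤ.+ 1 / suc n) (ℕ→ℚ (suc n)))
  (ℚᵘP.≃-trans (ℚᵘP.*-cong (toℚᵘ-fromℚᵘ (ℚᵘ.mkℚᵘ (ℤ.+ 1) n)) (toℚᵘ-ℤ→ℚ (ℤ.+ suc n)))
    (ℚᵘ.*≡* (begin
      (ℤ.+ 1 ℤ.* ℤ.+ suc n) ℤ.* ℤ.+ 1  ≡⟨ ℤP.*-identityʳ _ ⟩
      ℤ.+ 1 ℤ.* ℤ.+ suc n            ≡⟨ cong (λ m → ℤ.+ 1 ℤ.* ℤ.+ m) (sym (ℕP.*-identityʳ (suc n))) ⟩
      ℤ.+ 1 ℤ.* ℤ.+ (suc n ℕ.* 1)    ∎))))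
  where open ≡-Reasoning

n*1/n≡1 : ∀ n .{{_ : ℕ.NonZero n}} → ℕ→ℚ n * (ℤ.+ 1 / n) ≡ 1ℚ
n*1/n≡1 n = trans (*-comm (ℕ→ℚ n) (ℤ.+ 1 / n)) (1/n*n≡1 n)

1/[m*n]≡1/m*1/n : ∀ m n .{{_ : ℕ.NonZero m}} .{{_ : ℕ.NonZero n}} →
  (ℤ.+ 1 / (m ℕ.* n)) {{m*n≢0 m n}} ≡ (ℤ.+ 1 / m) * (ℤ.+ 1 / n)
1/[m*n]≡1/m*1/n (suc m) (suc n) = toℚᵘ-injective
  (ℚᵘP.≃-trans (toℚᵘ-fromℚᵘ (ℚᵘ.mkℚᵘ (ℤ.+ 1) (n ℕ.+ m ℕ.* suc n)))
    (ℚᵘP.≃-sym (ℚᵘP.≃-trans (toℚᵘ-homo-* (ℤ.+ 1 / suc m) (ℤ.+ 1 / suc n))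
      (ℚᵘP.*-cong (toℚᵘ-fromℚᵘ (ℚᵘ.mkℚᵘ (ℤ.+ 1) m)) (toℚᵘ-fromℚᵘ (ℚᵘ.mkℚᵘ (ℤ.+ 1) n))))))

inv!-suc : ∀ n → inv! (suc n) ≡ (ℤ.+ 1 / suc n) * inv! n
inv!-suc n = 1/[m*n]≡1/m*1/n (suc n) (n !) {{_}} {{n !≢0}}

double-suc : ∀ n → suc n ℕ.+ suc n ≡ suc (suc (n ℕ.+ n))
double-suc n = cong suc (ℕP.+-suc n n)

ℕ→ℚ-double-suc : ∀ n → ℕ→ℚ (suc (suc (n ℕ.+ n))) ≡ ℕ→ℚ (suc n) + ℕ→ℚ (suc n)
ℕ→ℚ-double-suc n = trans (cong ℕ→ℚ (sym (double-suc n))) (ℕ→ℚ-+ (suc n) (suc n))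

ℕ→ℚ-double-suc! : ∀ n → ℕ→ℚ ((suc n ℕ.+ suc n) !)
                       ≡ ℕ→ℚ (suc (suc (n ℕ.+ n))) * (ℕ→ℚ (suc (n ℕ.+ n)) * ℕ→ℚ ((n ℕ.+ n) !))
ℕ→ℚ-double-suc! n = trans (cong (λ k → ℕ→ℚ (k !)) (double-suc n))
  (trans (ℕ→ℚ-* (suc (suc (n ℕ.+ n))) (suc (n ℕ.+ n) ℕ.* (n ℕ.+ n) !))
         (cong (ℕ→ℚ (suc (suc (n ℕ.+ n))) *_) (ℕ→ℚ-* (suc (n ℕ.+ n)) ((n ℕ.+ n) !))))

inv!-double-suc : ∀ n → inv! (suc n ℕ.+ suc n)
                       ≡ (ℤ.+ 1 / suc (suc (n ℕ.+ n))) * ((ℤ.+ 1 / suc (n ℕ.+ n)) * inv! (n ℕ.+ n))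
inv!-double-suc n = trans (cong inv! (double-suc n))
  (trans (inv!-suc (suc (n ℕ.+ n))) (cong ((ℤ.+ 1 / suc (suc (n ℕ.+ n))) *_) (inv!-suc (n ℕ.+ n))))

inv!*n!≡1 : ∀ n → inv! n * ℕ→ℚ (n !) ≡ 1ℚ
inv!*n!≡1 n = 1/n*n≡1 (n !) {{n !≢0}}

ℕ→ℚ-cancelˡ-* : ∀ n .{{_ : ℕ.NonZero n}} {x y} → ℕ→ℚ n * x ≡ ℕ→ℚ n * y → x ≡ y
ℕ→ℚ-cancelˡ-* n {x} {y} eq = begin
  x                            ≡⟨ sym (cancel x) ⟩
  (ℤ.+ 1 / n) * (ℕ→ℚ n * x)    ≡⟨ cong ((ℤ.+ 1 / n) *_) eq ⟩
  (ℤ.+ 1 / n) * (ℕ→ℚ n * y)    ≡⟨ cancel y ⟩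
  y                            ∎
  where
  open ≡-Reasoning
  cancel : ∀ a → (ℤ.+ 1 / n) * (ℕ→ℚ n * a) ≡ a
  cancel a = trans (sym (*-assoc (ℤ.+ 1 / n) (ℕ→ℚ n) a)) (trans (cong (_* a) (1/n*n≡1 n)) (*-identityˡ a))

Σ-cong : ∀ N {f g : ℕ → ℚ} → (∀ i → i ≤ N → f i ≡ g i) → Σ[0… N ] f ≡ Σ[0… N ] g
Σ-cong zero    f≡g = f≡g 0 z≤n
Σ-cong (suc N) f≡g = cong₂ _+_ (Σ-cong N (λ i i≤N → f≡g i (ℕP.m≤n⇒m≤1+n i≤N))) (f≡g (suc N) ℕP.≤-refl)

Σ₁-cong : ∀ N {f g : ℕ → ℚ} → (∀ i → 1 ≤ i → i ≤ N → f i ≡ g i) → Σ[1… N ] f ≡ Σ[1… N ] g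
Σ₁-cong zero    f≡g = refl
Σ₁-cong (suc N) f≡g =
  cong₂ _+_ (Σ₁-cong N (λ i 1≤i i≤N → f≡g i 1≤i (ℕP.m≤n⇒m≤1+n i≤N))) (f≡g (suc N) (s≤s z≤n) ℕP.≤-refl)

Σ-zero : ∀ N {f : ℕ → ℚ} → (∀ i → i ≤ N → f i ≡ 0ℚ) → Σ[0… N ] f ≡ 0ℚ
Σ-zero zero    f≡0 = f≡0 0 z≤n
Σ-zero (suc N) f≡0 = trans (cong₂ _+_ (Σ-zero N (λ i i≤N → f≡0 i (ℕP.m≤n⇒m≤1+n i≤N))) (f≡0 (suc N) ℕP.≤-refl))
                           (+-identityˡ 0ℚ)

Σ-distrib-+ : ∀ N (f g : ℕ → ℚ) → Σ[0… N ] (λ i → f i + g i) ≡ Σ[0… N ] f + Σ[0… N ] g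
Σ-distrib-+ zero    f g = refl
Σ-distrib-+ (suc N) f g = trans (cong (_+ (f (suc N) + g (suc N))) (Σ-distrib-+ N f g))
                                (interchange (Σ[0… N ] f) (Σ[0… N ] g) (f (suc N)) (g (suc N)))
  where
  interchange : ∀ a b c d → (a + b) + (c + d) ≡ (a + c) + (b + d)
  interchange = solve-∀ ℚ-ring

*-distribˡ-Σ : ∀ N c (f : ℕ → ℚ) → c * Σ[0… N ] f ≡ Σ[0… N ] (λ i → c * f i)
*-distribˡ-Σ zero    c f = refl
*-distribˡ-Σ (suc N) c f = trans (*-distribˡ-+ c _ _) (cong (_+ c * f (suc N)) (*-distribˡ-Σ N c f))

*-distribˡ-Σ₁ : ∀ N c (f : ℕ → ℚ) → c * Σ[1… N ] f ≡ Σ[1… N ] (λ i → c * f i)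
*-distribˡ-Σ₁ zero    c f = *-zeroʳ c
*-distribˡ-Σ₁ (suc N) c f = trans (*-distribˡ-+ c _ _) (cong (_+ c * f (suc N)) (*-distribˡ-Σ₁ N c f))

Σ-suc : ∀ N (f : ℕ → ℚ) → Σ[0… suc N ] f ≡ f 0 + Σ[0… N ] (λ i → f (suc i))
Σ-suc zero    f = refl
Σ-suc (suc N) f = trans (cong (_+ f (suc (suc N))) (Σ-suc N f))
                        (+-assoc (f 0) (Σ[0… N ] (λ i → f (suc i))) (f (suc (suc N))))

Σ≡Σ₁ : ∀ N (f : ℕ → ℚ) → f 0 ≡ 0ℚ → Σ[0… N ] f ≡ Σ[1… N ] f
Σ≡Σ₁ zero    f f0≡0 = f0≡0
Σ≡Σ₁ (suc N) f f0≡0 = cong (_+ f (suc N)) (Σ≡Σ₁ N f f0≡0)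

Σ-truncate : ∀ M N (f : ℕ → ℚ) → M ≤ N → (∀ i → M < i → i ≤ N → f i ≡ 0ℚ) → Σ[0… N ] f ≡ Σ[0… M ] f
Σ-truncate M zero    f z≤n  f≡0 = refl
Σ-truncate M (suc N) f M≤1+N f≡0 with ℕP.m≤n⇒m<n∨m≡n M≤1+N
... | inj₂ refl        = refl
... | inj₁ (s≤s M≤N)   =
  trans (cong₂ _+_ (Σ-truncate M N f M≤N (λ i M<i i≤N → f≡0 i M<i (ℕP.m≤n⇒m≤1+n i≤N)))
                   (f≡0 (suc N) (s≤s M≤N) ℕP.≤-refl))
        (+-identityʳ _)

Σ₁-Σ-comm : ∀ M N (f : ℕ → ℕ → ℚ) →
  Σ[1… M ] (λ i → Σ[0… N ] (f i)) ≡ Σ[0… N ] (λ j → Σ[1… M ] (λ i → f i j))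
Σ₁-Σ-comm zero    N f = sym (Σ-zero N (λ _ _ → refl))
Σ₁-Σ-comm (suc M) N f = trans (cong (_+ Σ[0… N ] (f (suc M))) (Σ₁-Σ-comm M N f))
                              (sym (Σ-distrib-+ N _ (f (suc M))))

δ : ℕ → ℕ → ℚ
δ zero    zero    = 1ℚ
δ zero    (suc j) = 0ℚ
δ (suc m) zero    = 0ℚ
δ (suc m) (suc j) = δ m j

δ-≢ : ∀ m j → m ≢ j → δ m j ≡ 0ℚ
δ-≢ zero    zero    m≢j = contradiction refl m≢j
δ-≢ zero    (suc j) m≢j = refl
δ-≢ (suc m) zero    m≢j = refl
δ-≢ (suc m) (suc j) m≢j = δ-≢ m j (m≢j ∘ cong suc)

δ-refl : ∀ m → δ m m ≡ 1ℚ
δ-refl zero    = refl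
δ-refl (suc m) = δ-refl m

*-δ-swap : ∀ (f : ℕ → ℚ) m j → f m * δ m j ≡ f j * δ m j
*-δ-swap f zero    zero    = refl
*-δ-swap f zero    (suc j) = trans (*-zeroʳ (f 0)) (sym (*-zeroʳ (f (suc j))))
*-δ-swap f (suc m) zero    = trans (*-zeroʳ (f (suc m))) (sym (*-zeroʳ (f 0)))
*-δ-swap f (suc m) (suc j) = *-δ-swap (f ∘ suc) m j

δ*-off-diagonal : ∀ m j (f : ℕ → ℚ) → m ≢ j → δ m j * f j ≡ 0ℚ
δ*-off-diagonal m j f m≢j = trans (cong (_* f j) (δ-≢ m j m≢j)) (*-zeroˡ (f j))

Σ-δ-diagonal : ∀ m (f : ℕ → ℚ) → Σ[0… m ] (λ j → δ m j * f j) ≡ f m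
Σ-δ-diagonal zero    f = *-identityˡ (f 0)
Σ-δ-diagonal (suc m) f = begin
  Σ[0… m ] (λ j → δ (suc m) j * f j) + δ m m * f (suc m)
    ≡⟨ cong₂ _+_ (Σ-zero m (λ j j≤m → δ*-off-diagonal (suc m) j f (ℕP.>⇒≢ (s≤s j≤m))))
                 (cong (_* f (suc m)) (δ-refl m)) ⟩
  0ℚ + 1ℚ * f (suc m)
    ≡⟨ trans (+-identityˡ _) (*-identityˡ _) ⟩
  f (suc m) ∎
  where open ≡-Reasoning

Σ-δ : ∀ N m (f : ℕ → ℚ) → m ≤ N → Σ[0… N ] (λ j → δ m j * f j) ≡ f m
Σ-δ N m f m≤N = trans (Σ-truncate m N _ m≤N (λ j m<j _ → δ*-off-diagonal m j f (ℕP.<⇒≢ m<j)))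
                      (Σ-δ-diagonal m f)

infix 4 _≋_
_≋_ : Series → Series → Set
f ≋ g = ∀ N → f N ≡ g N

≋-refl : ∀ {f} → f ≋ f
≋-refl N = refl

≋-sym : ∀ {f g} → f ≋ g → g ≋ f
≋-sym f≋g N = sym (f≋g N)

≋-trans : ∀ {f g h} → f ≋ g → g ≋ h → f ≋ h
≋-trans f≋g g≋h N = trans (f≋g N) (g≋h N)

infixl 6 _⊕_
_⊕_ : Series → Series → Series
(f ⊕ g) N = f N + g N

infixr 7 _·_
_·_ : ℚ → Series → Series
(c · f) N = c * f N

𝟘 : Series
𝟘 _ = 0ℚ

cst : ℚ → Series
cst c zero    = c
cst c (suc _) = 0ℚ

shift : Series → Series
shift f N = f (suc N)

⊕-cong : ∀ {f f′ g g′} → f ≋ f′ → g ≋ g′ → f ⊕ g ≋ f′ ⊕ g′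
⊕-cong f≋f′ g≋g′ N = cong₂ _+_ (f≋f′ N) (g≋g′ N)

⊛-cong : ∀ {f f′ g g′} → f ≋ f′ → g ≋ g′ → f ⊛ g ≋ f′ ⊛ g′
⊛-cong f≋f′ g≋g′ N = Σ-cong N (λ i _ → cong₂ _*_ (f≋f′ i) (g≋g′ (N ∸ i)))

⊛-suc : ∀ f g N → (f ⊛ g) (suc N) ≡ f 0 * g (suc N) + (shift f ⊛ g) N
⊛-suc f g N = Σ-suc N (λ i → f i * g (suc N ∸ i))

⊛-suc′ : ∀ f g N → (f ⊛ g) (suc N) ≡ (f ⊛ shift g) N + f (suc N) * g 0
⊛-suc′ f g N = cong₂ _+_ (Σ-cong N (λ i i≤N → cong (λ k → f i * g k) (ℕP.+-∸-assoc 1 i≤N)))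
                         (cong (λ k → f (suc N) * g k) (ℕP.n∸n≡0 N))

⊛-comm : ∀ f g → f ⊛ g ≋ g ⊛ f
⊛-comm f g zero    = *-comm (f 0) (g 0)
⊛-comm f g (suc N) = begin
  (f ⊛ g) (suc N)                  ≡⟨ ⊛-suc f g N ⟩
  f 0 * g (suc N) + (shift f ⊛ g) N ≡⟨ cong₂ _+_ (*-comm (f 0) (g (suc N))) (⊛-comm (shift f) g N) ⟩
  g (suc N) * f 0 + (g ⊛ shift f) N ≡⟨ +-comm (g (suc N) * f 0) ((g ⊛ shift f) N) ⟩
  (g ⊛ shift f) N + g (suc N) * f 0 ≡⟨ sym (⊛-suc′ g f N) ⟩
  (g ⊛ f) (suc N)                  ∎
  where open ≡-Reasoning

⊛-distribˡ : ∀ f g h → f ⊛ (g ⊕ h) ≋ (f ⊛ g) ⊕ (f ⊛ h)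
⊛-distribˡ f g h N = trans (Σ-cong N (λ i _ → *-distribˡ-+ (f i) (g (N ∸ i)) (h (N ∸ i))))
                           (Σ-distrib-+ N (λ i → f i * g (N ∸ i)) (λ i → f i * h (N ∸ i)))

⊛-distribʳ : ∀ f g h → (g ⊕ h) ⊛ f ≋ (g ⊛ f) ⊕ (h ⊛ f)
⊛-distribʳ f g h N = trans (Σ-cong N (λ i _ → *-distribʳ-+ (f (N ∸ i)) (g i) (h i)))
                           (Σ-distrib-+ N (λ i → g i * f (N ∸ i)) (λ i → h i * f (N ∸ i)))

·-⊛ : ∀ c g h → (c · g) ⊛ h ≋ c · (g ⊛ h)
·-⊛ c g h N = trans (Σ-cong N (λ i _ → *-assoc c (g i) (h (N ∸ i))))
                    (sym (*-distribˡ-Σ N c (λ i → g i * h (N ∸ i))))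

⊛-assoc : ∀ f g h → (f ⊛ g) ⊛ h ≋ f ⊛ (g ⊛ h)
⊛-assoc f g h zero    = *-assoc (f 0) (g 0) (h 0)
⊛-assoc f g h (suc N) = begin
  ((f ⊛ g) ⊛ h) (suc N)
    ≡⟨ ⊛-suc (f ⊛ g) h N ⟩
  (f 0 * g 0) * h (suc N) + (shift (f ⊛ g) ⊛ h) N
    ≡⟨ cong (c₀ +_) (⊛-cong {g = h} (⊛-suc f g) ≋-refl N) ⟩
  (f 0 * g 0) * h (suc N) + (((f 0 · shift g) ⊕ (shift f ⊛ g)) ⊛ h) N
    ≡⟨ cong (c₀ +_) (⊛-distribʳ h (f 0 · shift g) (shift f ⊛ g) N) ⟩
  (f 0 * g 0) * h (suc N) + (((f 0 · shift g) ⊛ h) N + ((shift f ⊛ g) ⊛ h) N)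
    ≡⟨ cong (c₀ +_) (cong₂ _+_ (·-⊛ (f 0) (shift g) h N) (⊛-assoc (shift f) g h N)) ⟩
  (f 0 * g 0) * h (suc N) + (f 0 * (shift g ⊛ h) N + (shift f ⊛ (g ⊛ h)) N)
    ≡⟨ regroup (f 0) (g 0) (h (suc N)) ((shift g ⊛ h) N) ((shift f ⊛ (g ⊛ h)) N) ⟩
  f 0 * (g 0 * h (suc N) + (shift g ⊛ h) N) + (shift f ⊛ (g ⊛ h)) N
    ≡⟨ cong (λ x → f 0 * x + (shift f ⊛ (g ⊛ h)) N) (sym (⊛-suc g h N)) ⟩
  f 0 * (g ⊛ h) (suc N) + (shift f ⊛ (g ⊛ h)) N
    ≡⟨ sym (⊛-suc f (g ⊛ h) N) ⟩
  (f ⊛ (g ⊛ h)) (suc N) ∎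
  where
  open ≡-Reasoning
  c₀ = (f 0 * g 0) * h (suc N)
  regroup : ∀ a b c d e → (a * b) * c + (a * d + e) ≡ a * (b * c + d) + e
  regroup = solve-∀ ℚ-ring

⊛-zeroˡ : ∀ f → 𝟘 ⊛ f ≋ 𝟘
⊛-zeroˡ f N = Σ-zero N (λ i _ → *-zeroˡ (f (N ∸ i)))

⊛-zeroʳ : ∀ f → f ⊛ 𝟘 ≋ 𝟘
⊛-zeroʳ f N = trans (⊛-comm f 𝟘 N) (⊛-zeroˡ f N)

⊛-identityˡ : ∀ f → one ⊛ f ≋ f
⊛-identityˡ f zero    = *-identityˡ (f 0)
⊛-identityˡ f (suc N) = trans (⊛-suc one f N)
  (trans (cong₂ _+_ (*-identityˡ (f (suc N))) (⊛-zeroˡ f N)) (+-identityʳ _))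

⊛-identityʳ : ∀ f → f ⊛ one ≋ f
⊛-identityʳ f N = trans (⊛-comm f one N) (⊛-identityˡ f N)

cst-⊛ : ∀ c f → cst c ⊛ f ≋ c · f
cst-⊛ c f zero    = refl
cst-⊛ c f (suc N) = trans (⊛-suc (cst c) f N)
  (trans (cong (c * f (suc N) +_) (⊛-zeroˡ f N)) (+-identityʳ (c * f (suc N))))

series-commutativeSemiring : CommutativeSemiring 0ℓ 0ℓ
series-commutativeSemiring = record
  { Carrier = Series ; _≈_ = _≋_ ; _+_ = _⊕_ ; _*_ = _⊛_ ; 0# = 𝟘 ; 1# = one
  ; isCommutativeSemiring = record
    { isSemiring = record
      { isSemiringWithoutAnnihilatingZero = record
        { +-isCommutativeMonoid = record
          { isMonoid = record
            { isSemigroup = record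
              { isMagma = record
                { isEquivalence = record { refl = ≋-refl ; sym = ≋-sym ; trans = ≋-trans }
                ; ∙-cong = ⊕-cong }
              ; assoc = λ f g h N → +-assoc (f N) (g N) (h N) }
            ; identity = (λ f N → +-identityˡ (f N)) , (λ f N → +-identityʳ (f N)) }
          ; comm = λ f g N → +-comm (f N) (g N) }
        ; *-cong = ⊛-cong
        ; *-assoc = ⊛-assoc
        ; *-identity = ⊛-identityˡ , ⊛-identityʳ
        ; distrib = ⊛-distribˡ , ⊛-distribʳ }
      ; zero = ⊛-zeroˡ , ⊛-zeroʳ }
    ; *-comm = ⊛-comm } }

open import Algebra.Solver.Ring.NaturalCoefficients.Default series-commutativeSemiring
  using (con) renaming (solve to solveₛ; _:+_ to _⊞_; _:*_ to _⊠_; _:=_ to _≔_)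
module ≋-Reasoning = SetoidReasoning (CommutativeSemiring.setoid series-commutativeSemiring)

θ : Series → Series
θ f N = ℕ→ℚ N * f N

θ-cong : ∀ {f g} → f ≋ g → θ f ≋ θ g
θ-cong f≋g N = cong (ℕ→ℚ N *_) (f≋g N)

θ-⊕ : ∀ f g → θ (f ⊕ g) ≋ θ f ⊕ θ g
θ-⊕ f g N = *-distribˡ-+ (ℕ→ℚ N) (f N) (g N)

θ-⊛ : ∀ f g → θ (f ⊛ g) ≋ (θ f ⊛ g) ⊕ (f ⊛ θ g)
θ-⊛ f g N = begin
  ℕ→ℚ N * Σ[0… N ] (λ i → f i * g (N ∸ i))
    ≡⟨ *-distribˡ-Σ N (ℕ→ℚ N) _ ⟩
  Σ[0… N ] (λ i → ℕ→ℚ N * (f i * g (N ∸ i)))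
    ≡⟨ Σ-cong N (λ i i≤N → trans (cong (λ n → n * (f i * g (N ∸ i))) (split i≤N))
                                 (leibniz (ℕ→ℚ i) (ℕ→ℚ (N ∸ i)) (f i) (g (N ∸ i)))) ⟩
  Σ[0… N ] (λ i → ℕ→ℚ i * f i * g (N ∸ i) + f i * (ℕ→ℚ (N ∸ i) * g (N ∸ i)))
    ≡⟨ Σ-distrib-+ N _ _ ⟩
  ((θ f ⊛ g) ⊕ (f ⊛ θ g)) N ∎
  where
  open ≡-Reasoning
  split : ∀ {i} → i ≤ N → ℕ→ℚ N ≡ ℕ→ℚ i + ℕ→ℚ (N ∸ i)
  split {i} i≤N = trans (cong ℕ→ℚ (sym (ℕP.m+[n∸m]≡n i≤N))) (ℕ→ℚ-+ i (N ∸ i))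
  leibniz : ∀ a b x y → (a + b) * (x * y) ≡ a * x * y + x * (b * y)
  leibniz = solve-∀ ℚ-ring

θ-cst : ∀ c → θ (cst c) ≋ 𝟘
θ-cst c zero    = *-zeroˡ c
θ-cst c (suc N) = *-zeroʳ (ℕ→ℚ (suc N))

θ-one : θ one ≋ 𝟘
θ-one zero    = *-zeroˡ 1ℚ
θ-one (suc N) = *-zeroʳ (ℕ→ℚ (suc N))

θ-cst-⊛ : ∀ c f → θ (cst c ⊛ f) ≋ cst c ⊛ θ f
θ-cst-⊛ c f N = trans (θ-⊛ (cst c) f N)
  (trans (cong (_+ (cst c ⊛ θ f) N) (trans (⊛-cong (θ-cst c) (≋-refl {f}) N) (⊛-zeroˡ f N))) (+-identityˡ _))

cstℕ : ℕ → Series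
cstℕ n = cst (ℕ→ℚ n)

cstℕ-suc : ∀ n → cstℕ (suc n) ≋ one ⊕ cstℕ n
cstℕ-suc n zero    = ℕ→ℚ-suc n
cstℕ-suc n (suc N) = sym (+-identityˡ 0ℚ)

cstℕ-1 : cstℕ 1 ≋ one
cstℕ-1 zero    = refl
cstℕ-1 (suc N) = refl

θ-^ : ∀ z p → θ (z ^ₛ suc p) ≋ cstℕ (suc p) ⊛ ((z ^ₛ p) ⊛ θ z)
θ-^ z zero = begin
  θ (z ⊛ one)                    ≈⟨ θ-⊛ z one ⟩
  (θ z ⊛ one) ⊕ (z ⊛ θ one)      ≈⟨ ⊕-cong (≋-refl {θ z ⊛ one}) (⊛-cong {f = z} ≋-refl θ-one) ⟩
  (θ z ⊛ one) ⊕ (z ⊛ 𝟘)          ≈⟨ solveₛ 2 (λ a b → (a ⊠ con 1) ⊞ (b ⊠ con 0) ≔ con 1 ⊠ (con 1 ⊠ a))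
                                             ≋-refl (θ z) z ⟩
  one ⊛ (one ⊛ θ z)              ≈⟨ ⊛-cong {g = one ⊛ θ z} (≋-sym cstℕ-1) ≋-refl ⟩
  cstℕ 1 ⊛ (one ⊛ θ z)           ∎
  where open ≋-Reasoning
θ-^ z (suc p) = begin
  θ (z ⊛ (z ^ₛ suc p))
    ≈⟨ θ-⊛ z (z ^ₛ suc p) ⟩
  (θ z ⊛ (z ^ₛ suc p)) ⊕ (z ⊛ θ (z ^ₛ suc p))
    ≈⟨ ⊕-cong (≋-refl {θ z ⊛ (z ^ₛ suc p)}) (⊛-cong {f = z} ≋-refl (θ-^ z p)) ⟩
  (θ z ⊛ (z ⊛ (z ^ₛ p))) ⊕ (z ⊛ (cstℕ (suc p) ⊛ ((z ^ₛ p) ⊛ θ z)))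
    ≈⟨ solveₛ 4 (λ a b c n → (a ⊠ (b ⊠ c)) ⊞ (b ⊠ (n ⊠ (c ⊠ a))) ≔ (con 1 ⊞ n) ⊠ ((b ⊠ c) ⊠ a))
                ≋-refl (θ z) z (z ^ₛ p) (cstℕ (suc p)) ⟩
  (one ⊕ cstℕ (suc p)) ⊛ ((z ⊛ (z ^ₛ p)) ⊛ θ z)
    ≈⟨ ⊛-cong {g = (z ^ₛ suc p) ⊛ θ z} (≋-sym (cstℕ-suc (suc p))) ≋-refl ⟩
  cstℕ (suc (suc p)) ⊛ ((z ^ₛ suc p) ⊛ θ z) ∎
  where open ≋-Reasoning

X : Series
X zero    = 0ℚ
X (suc N) = one N

X² : Series
X² zero    = 0ℚ
X² (suc N) = X N

X⊛-suc : ∀ f N → (X ⊛ f) (suc N) ≡ f N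
X⊛-suc f N = trans (⊛-suc X f N) (trans (cong₂ _+_ (*-zeroˡ (f (suc N))) (⊛-identityˡ f N)) (+-identityˡ (f N)))

X²⊛-0 : ∀ f → (X² ⊛ f) 0 ≡ 0ℚ
X²⊛-0 f = *-zeroˡ (f 0)

X²⊛-1 : ∀ f → (X² ⊛ f) 1 ≡ 0ℚ
X²⊛-1 f = trans (⊛-suc X² f 0) (trans (cong₂ _+_ (*-zeroˡ (f 1)) (*-zeroˡ (f 0))) (+-identityˡ 0ℚ))

X²⊛-suc-suc : ∀ f N → (X² ⊛ f) (suc (suc N)) ≡ f N
X²⊛-suc-suc f N = trans (⊛-suc X² f (suc N))
  (trans (cong (_+ (X ⊛ f) (suc N)) (*-zeroˡ (f (suc (suc N))))) (trans (+-identityˡ _) (X⊛-suc f N)))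

two : Series
two = one ⊕ one

two-⊛ : ∀ f N → (two ⊛ f) N ≡ f N + f N
two-⊛ f N = trans (⊛-distribʳ f one one N) (cong₂ _+_ (⊛-identityˡ f N) (⊛-identityˡ f N))

θ-X² : θ X² ≋ two ⊛ X²
θ-X² N = trans (θX²≡X²+X² N) (sym (two-⊛ X² N))
  where
  θX²≡X²+X² : ∀ N → θ X² N ≡ X² N + X² N
  θX²≡X²+X² zero                = refl
  θX²≡X²+X² (suc zero)          = refl
  θX²≡X²+X² (suc (suc zero))    = refl
  θX²≡X²+X² (suc (suc (suc N))) = *-zeroʳ (ℕ→ℚ (suc (suc (suc N))))

-- The coefficient of x^M in (1 + γx²) z″ + γ x z′ = β z.
ODE : Series → ℚ → ℚ → Set
ODE z γ β = ∀ M → (ℕ→ℚ (suc (suc M)) * ℕ→ℚ (suc M)) * z (suc (suc M)) + γ * (ℕ→ℚ M * ℕ→ℚ M) * z M ≡ β * z M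

module ODESolution (z : Series) (γ β : ℚ) (z0≡0 : z 0 ≡ 0ℚ) (z1≡1 : z 1 ≡ 1ℚ) (ode : ODE z γ β) where

  Γ B A : Series
  Γ = cst γ
  B = cst β
  A = one ⊕ Γ ⊛ X²

  A⊛-coeff : ∀ h N → (A ⊛ h) N ≡ h N + γ * (X² ⊛ h) N
  A⊛-coeff h N = trans (⊛-distribʳ h one (Γ ⊛ X²) N)
    (cong₂ _+_ (⊛-identityˡ h N) (trans (⊛-assoc Γ X² h N) (cst-⊛ γ (X² ⊛ h) N)))

  ode-θ-low : ∀ N → ℕ→ℚ N * ℕ→ℚ N ≡ ℕ→ℚ N → (∀ h → (X² ⊛ h) N ≡ 0ℚ) →
              (A ⊛ θ (θ z)) N ≡ (θ z ⊕ B ⊛ (X² ⊛ z)) N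
  ode-θ-low N N²≡N X²⊛h≡0 = begin
    (A ⊛ θ (θ z)) N                       ≡⟨ A⊛-coeff (θ (θ z)) N ⟩
    n * (n * z N) + γ * (X² ⊛ θ (θ z)) N  ≡⟨ cong₂ (λ a b → a + γ * b)
                                               (trans (sym (*-assoc n n (z N))) (cong (_* z N) N²≡N))
                                               (X²⊛h≡0 (θ (θ z))) ⟩
    n * z N + γ * 0ℚ                      ≡⟨ cong (n * z N +_) (trans (*-zeroʳ γ) (sym (*-zeroʳ β))) ⟩
    n * z N + β * 0ℚ                      ≡⟨ cong (λ w → n * z N + β * w) (sym (X²⊛h≡0 z)) ⟩
    n * z N + β * (X² ⊛ z) N              ≡⟨ cong (n * z N +_) (sym (cst-⊛ β (X² ⊛ z) N)) ⟩
    (θ z ⊕ B ⊛ (X² ⊛ z)) N                ∎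
    where
    open ≡-Reasoning
    n = ℕ→ℚ N

  ode-θ : A ⊛ θ (θ z) ≋ θ z ⊕ B ⊛ (X² ⊛ z)
  ode-θ zero          = ode-θ-low 0 refl X²⊛-0
  ode-θ (suc zero)    = ode-θ-low 1 refl X²⊛-1
  ode-θ (suc (suc M)) = begin
    (A ⊛ θ (θ z)) (suc (suc M))                 ≡⟨ A⊛-coeff (θ (θ z)) (suc (suc M)) ⟩
    n₂ * (n₂ * x) + γ * (X² ⊛ θ (θ z)) (suc (suc M))
                                                ≡⟨ cong (λ w → n₂ * (n₂ * x) + γ * w) (X²⊛-suc-suc (θ (θ z)) M) ⟩
    n₂ * (n₂ * x) + γ * (m * (m * y))           ≡⟨ cong (λ w → w * (w * x) + γ * (m * (m * y))) (ℕ→ℚ-suc (suc M)) ⟩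
    (1ℚ + n₁) * ((1ℚ + n₁) * x) + γ * (m * (m * y)) ≡⟨ expand n₁ m x y γ ⟩
    (1ℚ + n₁) * x + ((1ℚ + n₁) * n₁ * x + γ * (m * m) * y)
      ≡⟨ cong (λ w → w * x + (w * n₁ * x + γ * (m * m) * y)) (sym (ℕ→ℚ-suc (suc M))) ⟩
    n₂ * x + (n₂ * n₁ * x + γ * (m * m) * y)   ≡⟨ cong (n₂ * x +_) (ode M) ⟩
    n₂ * x + β * y                              ≡⟨ cong (λ w → n₂ * x + β * w) (sym (X²⊛-suc-suc z M)) ⟩
    n₂ * x + β * (X² ⊛ z) (suc (suc M))         ≡⟨ cong (n₂ * x +_) (sym (cst-⊛ β (X² ⊛ z) (suc (suc M)))) ⟩
    (θ z ⊕ B ⊛ (X² ⊛ z)) (suc (suc M))          ∎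
    where
    open ≡-Reasoning
    n₂ = ℕ→ℚ (suc (suc M))
    n₁ = ℕ→ℚ (suc M)
    m = ℕ→ℚ M
    x = z (suc (suc M))
    y = z M
    expand : ∀ n₁ m x y g → (1ℚ + n₁) * ((1ℚ + n₁) * x) + g * (m * (m * y))
                          ≡ (1ℚ + n₁) * x + ((1ℚ + n₁) * n₁ * x + g * (m * m) * y)
    expand = solve-∀ ℚ-ring

  P L W R : Series
  P = θ z ⊛ θ z
  L = A ⊛ P
  W = one ⊕ B ⊛ (z ⊛ z)
  R = X² ⊛ W

  θ-A : θ A ≋ 𝟘 ⊕ Γ ⊛ (two ⊛ X²)
  θ-A = ≋-trans (θ-⊕ one (Γ ⊛ X²)) (⊕-cong θ-one (≋-trans (θ-cst-⊛ γ X²) (⊛-cong {f = Γ} ≋-refl θ-X²)))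

  θ-L : θ L ≋ two ⊛ (Γ ⊛ (X² ⊛ P)) ⊕ two ⊛ (θ z ⊛ (θ z ⊕ B ⊛ (X² ⊛ z)))
  θ-L = begin
    θ (A ⊛ P)
      ≈⟨ θ-⊛ A P ⟩
    θ A ⊛ P ⊕ A ⊛ θ P
      ≈⟨ ⊕-cong (⊛-cong {g = P} θ-A ≋-refl) (⊛-cong {f = A} ≋-refl (θ-⊛ (θ z) (θ z))) ⟩
    (𝟘 ⊕ Γ ⊛ (two ⊛ X²)) ⊛ P ⊕ A ⊛ (θ (θ z) ⊛ θ z ⊕ θ z ⊛ θ (θ z))
      ≈⟨ solveₛ 4 (λ g x t tt → (con 0 ⊞ g ⊠ (con 2 ⊠ x)) ⊠ (t ⊠ t) ⊞ (con 1 ⊞ g ⊠ x) ⊠ (tt ⊠ t ⊞ t ⊠ tt)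
                             ≔ con 2 ⊠ (g ⊠ (x ⊠ (t ⊠ t))) ⊞ con 2 ⊠ (t ⊠ ((con 1 ⊞ g ⊠ x) ⊠ tt)))
                  ≋-refl Γ X² (θ z) (θ (θ z)) ⟩
    two ⊛ (Γ ⊛ (X² ⊛ P)) ⊕ two ⊛ (θ z ⊛ (A ⊛ θ (θ z)))
      ≈⟨ ⊕-cong (≋-refl {two ⊛ (Γ ⊛ (X² ⊛ P))}) (⊛-cong {f = two} ≋-refl (⊛-cong {f = θ z} ≋-refl ode-θ)) ⟩
    two ⊛ (Γ ⊛ (X² ⊛ P)) ⊕ two ⊛ (θ z ⊛ (θ z ⊕ B ⊛ (X² ⊛ z))) ∎
    where open ≋-Reasoning

  θ-R : θ R ≋ (two ⊛ X²) ⊛ W ⊕ X² ⊛ (𝟘 ⊕ B ⊛ (θ z ⊛ z ⊕ z ⊛ θ z))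
  θ-R = ≋-trans (θ-⊛ X² W) (⊕-cong (⊛-cong {g = W} θ-X² ≋-refl) (⊛-cong {f = X²} ≋-refl
          (≋-trans (θ-⊕ one (B ⊛ (z ⊛ z)))
            (⊕-cong θ-one (≋-trans (θ-cst-⊛ β (z ⊛ z)) (⊛-cong {f = B} ≋-refl (θ-⊛ z z)))))))

  θ-L+2R≋2L+θ-R : θ L ⊕ two ⊛ R ≋ two ⊛ L ⊕ θ R
  θ-L+2R≋2L+θ-R = begin
    θ L ⊕ two ⊛ R
      ≈⟨ ⊕-cong θ-L (≋-refl {two ⊛ R}) ⟩
    (two ⊛ (Γ ⊛ (X² ⊛ P)) ⊕ two ⊛ (θ z ⊛ (θ z ⊕ B ⊛ (X² ⊛ z)))) ⊕ two ⊛ R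
      ≈⟨ solveₛ 5 (λ g x t b zz →
              (con 2 ⊠ (g ⊠ (x ⊠ (t ⊠ t))) ⊞ con 2 ⊠ (t ⊠ (t ⊞ b ⊠ (x ⊠ zz)))) ⊞ con 2 ⊠ (x ⊠ (con 1 ⊞ b ⊠ (zz ⊠ zz)))
              ≔ con 2 ⊠ ((con 1 ⊞ g ⊠ x) ⊠ (t ⊠ t))
                ⊞ ((con 2 ⊠ x) ⊠ (con 1 ⊞ b ⊠ (zz ⊠ zz)) ⊞ x ⊠ (con 0 ⊞ b ⊠ (t ⊠ zz ⊞ zz ⊠ t))))
                  ≋-refl Γ X² (θ z) B z ⟩
    two ⊛ L ⊕ ((two ⊛ X²) ⊛ W ⊕ X² ⊛ (𝟘 ⊕ B ⊛ (θ z ⊛ z ⊕ z ⊛ θ z)))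
      ≈⟨ ⊕-cong (≋-refl {two ⊛ L}) (≋-sym θ-R) ⟩
    two ⊛ L ⊕ θ R ∎
    where open ≋-Reasoning

  θz0≡0 : θ z 0 ≡ 0ℚ
  θz0≡0 = *-zeroˡ (z 0)

  θz1≡1 : θ z 1 ≡ 1ℚ
  θz1≡1 = trans (cong (1ℚ *_) z1≡1) (*-identityˡ 1ℚ)

  -- x² times the first integral (1 + γx²) z′² = 1 + βz².  Coefficientwise, θ-L+2R≋2L+θ-R reads
  -- (N − 2) L N = (N − 2) R N, which leaves only the coefficients of degree at most 2 to check.
  first-integral : L ≋ R
  first-integral zero = begin
    L 0                             ≡⟨ A⊛-coeff P 0 ⟩
    θ z 0 * θ z 0 + γ * (X² ⊛ P) 0  ≡⟨ cong₂ (λ a w → a * a + γ * w) θz0≡0 (X²⊛-0 P) ⟩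
    0ℚ * 0ℚ + γ * 0ℚ                ≡⟨ vanish γ ⟩
    0ℚ                              ≡⟨ sym (X²⊛-0 W) ⟩
    R 0                             ∎
    where
    open ≡-Reasoning
    vanish : ∀ g → 0ℚ * 0ℚ + g * 0ℚ ≡ 0ℚ
    vanish = solve-∀ ℚ-ring
  first-integral (suc zero) = begin
    L 1                                                  ≡⟨ A⊛-coeff P 1 ⟩
    (θ z 0 * θ z 1 + θ z 1 * θ z 0) + γ * (X² ⊛ P) 1     ≡⟨ cong₂ (λ a w → (a * θ z 1 + θ z 1 * a) + γ * w)
                                                               θz0≡0 (X²⊛-1 P) ⟩
    (0ℚ * θ z 1 + θ z 1 * 0ℚ) + γ * 0ℚ                   ≡⟨ vanish γ (θ z 1) ⟩
    0ℚ                                                   ≡⟨ sym (X²⊛-1 W) ⟩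
    R 1                                                  ∎
    where
    open ≡-Reasoning
    vanish : ∀ g b → (0ℚ * b + b * 0ℚ) + g * 0ℚ ≡ 0ℚ
    vanish = solve-∀ ℚ-ring
  first-integral (suc (suc zero)) = begin
    L 2
      ≡⟨ A⊛-coeff P 2 ⟩
    ((θ z 0 * θ z 2 + θ z 1 * θ z 1) + θ z 2 * θ z 0) + γ * (X² ⊛ P) 2
      ≡⟨ cong (λ w → ((θ z 0 * θ z 2 + θ z 1 * θ z 1) + θ z 2 * θ z 0) + γ * w) (X²⊛-suc-suc P 0) ⟩
    ((θ z 0 * θ z 2 + θ z 1 * θ z 1) + θ z 2 * θ z 0) + γ * (θ z 0 * θ z 0)
      ≡⟨ cong₂ (λ a b → ((a * θ z 2 + b * b) + θ z 2 * a) + γ * (a * a)) θz0≡0 θz1≡1 ⟩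
    ((0ℚ * θ z 2 + 1ℚ * 1ℚ) + θ z 2 * 0ℚ) + γ * (0ℚ * 0ℚ)
      ≡⟨ simplify γ β (θ z 2) ⟩
    1ℚ + β * (0ℚ * 0ℚ)
      ≡⟨ cong (λ a → 1ℚ + β * (a * a)) (sym z0≡0) ⟩
    1ℚ + β * (z 0 * z 0)
      ≡⟨ cong (1ℚ +_) (sym (cst-⊛ β (z ⊛ z) 0)) ⟩
    W 0
      ≡⟨ sym (X²⊛-suc-suc W 0) ⟩
    R 2 ∎
    where
    open ≡-Reasoning
    simplify : ∀ g b c → ((0ℚ * c + 1ℚ * 1ℚ) + c * 0ℚ) + g * (0ℚ * 0ℚ) ≡ 1ℚ + b * (0ℚ * 0ℚ)
    simplify = solve-∀ ℚ-ring
  first-integral (suc (suc (suc M))) = ℕ→ℚ-cancelˡ-* (suc M) (+-cancelʳ S _ _ (begin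
    k * L N + S                              ≡⟨ move k (L N) (R N) ⟩
    (1ℚ + (1ℚ + k)) * L N + (R N + R N)      ≡⟨ cong (λ n → n * L N + (R N + R N)) (sym N≡2+k) ⟩
    ℕ→ℚ N * L N + (R N + R N)                ≡⟨ coefficient ⟩
    (L N + L N) + ℕ→ℚ N * R N                ≡⟨ cong (λ n → (L N + L N) + n * R N) N≡2+k ⟩
    (L N + L N) + (1ℚ + (1ℚ + k)) * R N      ≡⟨ move′ k (L N) (R N) ⟩
    k * R N + S                              ∎))
    where
    open ≡-Reasoning
    N = suc (suc (suc M))
    k = ℕ→ℚ (suc M)
    S = (L N + L N) + (R N + R N)
    N≡2+k : ℕ→ℚ N ≡ 1ℚ + (1ℚ + k)
    N≡2+k = trans (ℕ→ℚ-suc (suc (suc M))) (cong (1ℚ +_) (ℕ→ℚ-suc (suc M)))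
    coefficient : ℕ→ℚ N * L N + (R N + R N) ≡ (L N + L N) + ℕ→ℚ N * R N
    coefficient = trans (cong (ℕ→ℚ N * L N +_) (sym (two-⊛ R N)))
                        (trans (θ-L+2R≋2L+θ-R N) (cong (_+ ℕ→ℚ N * R N) (two-⊛ L N)))
    move : ∀ k l r → k * l + ((l + l) + (r + r)) ≡ (1ℚ + (1ℚ + k)) * l + (r + r)
    move = solve-∀ ℚ-ring
    move′ : ∀ k l r → (l + l) + (1ℚ + (1ℚ + k)) * r ≡ k * r + ((l + l) + (r + r))
    move′ = solve-∀ ℚ-ring

  -- For u = z^p with p = q + 2:  (1 + γx²) u″ + γ x u′ = p (p − 1) z^q + β p² u.
  module Power (q : ℕ) where

    p p-1 zq zq+1 u V : Series
    p    = cstℕ (suc (suc q))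
    p-1  = cstℕ (suc q)
    zq   = z ^ₛ q
    zq+1 = z ^ₛ suc q
    u    = z ^ₛ suc (suc q)
    V    = p ⊛ (p-1 ⊛ zq) ⊕ B ⊛ (p ⊛ (p ⊛ u))

    θθu : θ (θ u) ≋ p ⊛ ((p-1 ⊛ (zq ⊛ θ z)) ⊛ θ z ⊕ zq+1 ⊛ θ (θ z))
    θθu = ≋-trans (θ-cong (θ-^ z (suc q)))
            (≋-trans (θ-cst-⊛ (ℕ→ℚ (suc (suc q))) (zq+1 ⊛ θ z))
              (⊛-cong {f = p} ≋-refl (≋-trans (θ-⊛ zq+1 (θ z))
                (⊕-cong (⊛-cong {g = θ z} (θ-^ z q) ≋-refl) (≋-refl {zq+1 ⊛ θ (θ z)})))))

    ode-θ-power : A ⊛ θ (θ u) ≋ θ u ⊕ X² ⊛ V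
    ode-θ-power = begin
      A ⊛ θ (θ u)
        ≈⟨ ⊛-cong {f = A} ≋-refl θθu ⟩
      A ⊛ (p ⊛ ((p-1 ⊛ (zq ⊛ θ z)) ⊛ θ z ⊕ zq+1 ⊛ θ (θ z)))
        ≈⟨ solveₛ 8 (λ np n1 zq t tt g x c → (con 1 ⊞ g ⊠ x) ⊠ (np ⊠ ((n1 ⊠ (zq ⊠ t)) ⊠ t ⊞ c ⊠ tt))
                      ≔ np ⊠ (n1 ⊠ (zq ⊠ ((con 1 ⊞ g ⊠ x) ⊠ (t ⊠ t)))) ⊞ np ⊠ (c ⊠ ((con 1 ⊞ g ⊠ x) ⊠ tt)))
                    ≋-refl p p-1 zq (θ z) (θ (θ z)) Γ X² zq+1 ⟩
      p ⊛ (p-1 ⊛ (zq ⊛ L)) ⊕ p ⊛ (zq+1 ⊛ (A ⊛ θ (θ z)))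
        ≈⟨ ⊕-cong (⊛-cong {f = p} ≋-refl (⊛-cong {f = p-1} ≋-refl (⊛-cong {f = zq} ≋-refl first-integral)))
                  (⊛-cong {f = p} ≋-refl (⊛-cong {f = zq+1} ≋-refl ode-θ)) ⟩
      p ⊛ (p-1 ⊛ (zq ⊛ R)) ⊕ p ⊛ (zq+1 ⊛ (θ z ⊕ B ⊛ (X² ⊛ z)))
        ≈⟨ ⊕-cong (⊛-cong {g = p-1 ⊛ (zq ⊛ R)} (cstℕ-suc (suc q)) ≋-refl)
                  (⊛-cong {g = zq+1 ⊛ (θ z ⊕ B ⊛ (X² ⊛ z))} (cstℕ-suc (suc q)) ≋-refl) ⟩
      (one ⊕ p-1) ⊛ (p-1 ⊛ (zq ⊛ R)) ⊕ (one ⊕ p-1) ⊛ (zq+1 ⊛ (θ z ⊕ B ⊛ (X² ⊛ z)))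
        ≈⟨ solveₛ 6 (λ n1 zq t x b zz →
              (con 1 ⊞ n1) ⊠ (n1 ⊠ (zq ⊠ (x ⊠ (con 1 ⊞ b ⊠ (zz ⊠ zz)))))
                ⊞ (con 1 ⊞ n1) ⊠ ((zz ⊠ zq) ⊠ (t ⊞ b ⊠ (x ⊠ zz)))
              ≔ (con 1 ⊞ n1) ⊠ ((zz ⊠ zq) ⊠ t)
                ⊞ x ⊠ ((con 1 ⊞ n1) ⊠ (n1 ⊠ zq) ⊞ b ⊠ ((con 1 ⊞ n1) ⊠ ((con 1 ⊞ n1) ⊠ (zz ⊠ (zz ⊠ zq))))))
                    ≋-refl p-1 zq (θ z) X² B z ⟩
      (one ⊕ p-1) ⊛ (zq+1 ⊛ θ z) ⊕ X² ⊛ ((one ⊕ p-1) ⊛ (p-1 ⊛ zq) ⊕ B ⊛ ((one ⊕ p-1) ⊛ ((one ⊕ p-1) ⊛ u)))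
        ≈⟨ ⊕-cong (⊛-cong {g = zq+1 ⊛ θ z} p≋1+p-1 ≋-refl)
                  (⊛-cong {f = X²} ≋-refl (⊕-cong (⊛-cong {g = p-1 ⊛ zq} p≋1+p-1 ≋-refl)
                    (⊛-cong {f = B} ≋-refl (⊛-cong p≋1+p-1 (⊛-cong {g = u} p≋1+p-1 ≋-refl))))) ⟩
      p ⊛ (zq+1 ⊛ θ z) ⊕ X² ⊛ V
        ≈⟨ ⊕-cong (≋-sym (θ-^ z (suc q))) (≋-refl {X² ⊛ V}) ⟩
      θ u ⊕ X² ⊛ V ∎
      where
      open ≋-Reasoning
      p≋1+p-1 : one ⊕ p-1 ≋ p
      p≋1+p-1 = ≋-sym (cstℕ-suc (suc q))

    recurrence : ∀ N →
      (ℕ→ℚ (suc (suc N)) * ℕ→ℚ (suc N)) * u (suc (suc N)) + γ * (ℕ→ℚ N * ℕ→ℚ N) * u N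
      ≡ (ℕ→ℚ (suc (suc q)) * ℕ→ℚ (suc q)) * zq N + β * (ℕ→ℚ (suc (suc q)) * ℕ→ℚ (suc (suc q))) * u N
    recurrence N = +-cancelʳ (n₂ * x) _ _ (begin
      (n₂ * n₁ * x + γ * (m * m) * y) + n₂ * x
        ≡⟨ cong (λ k → (k * n₁ * x + γ * (m * m) * y) + k * x) n₂≡1+n₁ ⟩
      ((1ℚ + n₁) * n₁ * x + γ * (m * m) * y) + (1ℚ + n₁) * x
        ≡⟨ collect n₁ m x y γ ⟩
      (1ℚ + n₁) * ((1ℚ + n₁) * x) + γ * (m * (m * y))
        ≡⟨ cong (λ k → k * (k * x) + γ * (m * (m * y))) (sym n₂≡1+n₁) ⟩
      n₂ * (n₂ * x) + γ * (m * (m * y))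
        ≡⟨ cong (λ w → n₂ * (n₂ * x) + γ * w) (sym (X²⊛-suc-suc (θ (θ u)) N)) ⟩
      n₂ * (n₂ * x) + γ * (X² ⊛ θ (θ u)) (suc (suc N))
        ≡⟨ sym (A⊛-coeff (θ (θ u)) (suc (suc N))) ⟩
      (A ⊛ θ (θ u)) (suc (suc N))
        ≡⟨ ode-θ-power (suc (suc N)) ⟩
      n₂ * x + (X² ⊛ V) (suc (suc N))
        ≡⟨ cong (n₂ * x +_) (X²⊛-suc-suc V N) ⟩
      n₂ * x + V N
        ≡⟨ cong (n₂ * x +_) (cong₂ _+_ (trans (cst-⊛ a (p-1 ⊛ zq) N) (cong (a *_) (cst-⊛ b zq N)))
                       (trans (cst-⊛ β (p ⊛ (p ⊛ u)) N) (cong (β *_) (trans (cst-⊛ a (p ⊛ u) N) (cong (a *_) (cst-⊛ a u N)))))) ⟩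
      n₂ * x + (a * (b * w) + β * (a * (a * y)))
        ≡⟨ collect′ n₂ x a b w β y ⟩
      ((a * b) * w + β * (a * a) * y) + n₂ * x ∎)
      where
      open ≡-Reasoning
      n₂ = ℕ→ℚ (suc (suc N))
      n₁ = ℕ→ℚ (suc N)
      m  = ℕ→ℚ N
      x  = u (suc (suc N))
      y  = u N
      w  = zq N
      a  = ℕ→ℚ (suc (suc q))
      b  = ℕ→ℚ (suc q)
      n₂≡1+n₁ : n₂ ≡ 1ℚ + n₁
      n₂≡1+n₁ = ℕ→ℚ-suc (suc N)
      collect : ∀ n₁ m x y g → ((1ℚ + n₁) * n₁ * x + g * (m * m) * y) + (1ℚ + n₁) * x
                             ≡ (1ℚ + n₁) * ((1ℚ + n₁) * x) + g * (m * (m * y))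
      collect = solve-∀ ℚ-ring
      collect′ : ∀ n₂ x a b w β y → n₂ * x + (a * (b * w) + β * (a * (a * y)))
                                  ≡ ((a * b) * w + β * (a * a) * y) + n₂ * x
      collect′ = solve-∀ ℚ-ring

  T : ℕ → ℕ → ℚ
  T l j = (ℕ→ℚ ((l ℕ.+ l) !) * (z ^ₛ (j ℕ.+ j)) (l ℕ.+ l)) * inv! (j ℕ.+ j)

  T-rec : ∀ l j → T (suc l) (suc j) + γ * (ℕ→ℚ (l ℕ.+ l) * ℕ→ℚ (l ℕ.+ l)) * T l (suc j)
                ≡ T l j + β * (ℕ→ℚ (suc (suc (j ℕ.+ j))) * ℕ→ℚ (suc (suc (j ℕ.+ j)))) * T l (suc j)
  T-rec l j = begin
    T (suc l) (suc j) + γ * (m * m) * T l (suc j)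
      ≡⟨ cong₂ (λ x y → x + γ * (m * m) * y) T-suc-suc T-suc ⟩
    (n₂ * (n₁ * F)) * U′ * (r₂ * (r₁ * I)) + γ * (m * m) * ((F * U) * (r₂ * (r₁ * I)))
      ≡⟨ factor n₂ n₁ F U′ r₂ r₁ I γ m U ⟩
    (F * (r₂ * (r₁ * I))) * ((n₂ * n₁) * U′ + γ * (m * m) * U)
      ≡⟨ cong ((F * (r₂ * (r₁ * I))) *_) (Power.recurrence (j ℕ.+ j) (l ℕ.+ l)) ⟩
    (F * (r₂ * (r₁ * I))) * ((a * b) * Z + β * (a * a) * U)
      ≡⟨ unfactor F r₂ r₁ I a b Z β U ⟩
    ((F * Z) * I) * ((a * r₂) * (b * r₁)) + β * (a * a) * ((F * U) * (r₂ * (r₁ * I)))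
      ≡⟨ cong₂ (λ x y → ((F * Z) * I) * x + β * (a * a) * y)
           (trans (cong₂ _*_ (n*1/n≡1 (suc (suc (j ℕ.+ j)))) (n*1/n≡1 (suc (j ℕ.+ j)))) (*-identityˡ 1ℚ))
           (sym T-suc) ⟩
    ((F * Z) * I) * 1ℚ + β * (a * a) * T l (suc j)
      ≡⟨ cong (_+ β * (a * a) * T l (suc j)) (*-identityʳ ((F * Z) * I)) ⟩
    T l j + β * (a * a) * T l (suc j) ∎
    where
    open ≡-Reasoning
    m  = ℕ→ℚ (l ℕ.+ l)
    n₂ = ℕ→ℚ (suc (suc (l ℕ.+ l)))
    n₁ = ℕ→ℚ (suc (l ℕ.+ l))
    F  = ℕ→ℚ ((l ℕ.+ l) !)
    U′ = (z ^ₛ suc (suc (j ℕ.+ j))) (suc (suc (l ℕ.+ l)))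
    U  = (z ^ₛ suc (suc (j ℕ.+ j))) (l ℕ.+ l)
    Z  = (z ^ₛ (j ℕ.+ j)) (l ℕ.+ l)
    a  = ℕ→ℚ (suc (suc (j ℕ.+ j)))
    b  = ℕ→ℚ (suc (j ℕ.+ j))
    r₂ = ℤ.+ 1 / suc (suc (j ℕ.+ j))
    r₁ = ℤ.+ 1 / suc (j ℕ.+ j)
    I  = inv! (j ℕ.+ j)
    T-suc-suc : T (suc l) (suc j) ≡ (n₂ * (n₁ * F)) * U′ * (r₂ * (r₁ * I))
    T-suc-suc = cong₂ _*_ (cong₂ _*_ (ℕ→ℚ-double-suc! l) (cong₂ (λ p k → (z ^ₛ p) k) (double-suc j) (double-suc l)))
                          (inv!-double-suc j)
    T-suc : T l (suc j) ≡ (F * U) * (r₂ * (r₁ * I))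
    T-suc = cong₂ _*_ (cong (λ p → F * (z ^ₛ p) (l ℕ.+ l)) (double-suc j)) (inv!-double-suc j)
    factor : ∀ n₂ n₁ F U′ r₂ r₁ I g m U →
      (n₂ * (n₁ * F)) * U′ * (r₂ * (r₁ * I)) + g * (m * m) * ((F * U) * (r₂ * (r₁ * I)))
      ≡ (F * (r₂ * (r₁ * I))) * ((n₂ * n₁) * U′ + g * (m * m) * U)
    factor = solve-∀ ℚ-ring
    unfactor : ∀ F r₂ r₁ I a b Z β U →
      (F * (r₂ * (r₁ * I))) * ((a * b) * Z + β * (a * a) * U)
      ≡ ((F * Z) * I) * ((a * r₂) * (b * r₁)) + β * (a * a) * ((F * U) * (r₂ * (r₁ * I)))
    unfactor = solve-∀ ℚ-ring

  T-0 : ∀ j → T 0 j ≡ δ 0 j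
  T-0 zero    = refl
  T-0 (suc j) = begin
    (1ℚ * (z 0 * w)) * inv! (suc j ℕ.+ suc j) ≡⟨ cong (λ c → (1ℚ * (c * w)) * inv! (suc j ℕ.+ suc j)) z0≡0 ⟩
    (1ℚ * (0ℚ * w)) * inv! (suc j ℕ.+ suc j)  ≡⟨ vanish w (inv! (suc j ℕ.+ suc j)) ⟩
    0ℚ                                        ∎
    where
    open ≡-Reasoning
    w = (z ^ₛ (j ℕ.+ suc j)) 0
    vanish : ∀ a b → (1ℚ * (0ℚ * a)) * b ≡ 0ℚ
    vanish = solve-∀ ℚ-ring

  T-suc-0 : ∀ l → T (suc l) 0 ≡ 0ℚ
  T-suc-0 l = trans (cong (_* inv! 0) (*-zeroʳ (ℕ→ℚ ((suc l ℕ.+ suc l) !)))) (*-zeroˡ (inv! 0))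

  T-above : ∀ l j → l < j → T l j ≡ 0ℚ
  T-above zero    (suc j) _         = T-0 (suc j)
  T-above (suc l) (suc j) (s≤s l<j) = +-cancelʳ _ _ _ (begin
    T (suc l) (suc j) + γ * c * T l (suc j) ≡⟨ T-rec l j ⟩
    T l j + β * d * T l (suc j)            ≡⟨ cong₂ (λ x y → x + β * d * y) (T-above l j l<j) T-l-suc-j≡0 ⟩
    0ℚ + β * d * 0ℚ                         ≡⟨ shuffle β γ c d ⟩
    0ℚ + γ * c * 0ℚ                         ≡⟨ cong (λ y → 0ℚ + γ * c * y) (sym T-l-suc-j≡0) ⟩
    0ℚ + γ * c * T l (suc j)                ∎)
    where
    open ≡-Reasoning
    c = ℕ→ℚ (l ℕ.+ l) * ℕ→ℚ (l ℕ.+ l)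
    d = ℕ→ℚ (suc (suc (j ℕ.+ j))) * ℕ→ℚ (suc (suc (j ℕ.+ j)))
    T-l-suc-j≡0 : T l (suc j) ≡ 0ℚ
    T-l-suc-j≡0 = T-above l (suc j) (ℕP.m≤n⇒m≤1+n l<j)
    shuffle : ∀ β γ c d → 0ℚ + β * d * 0ℚ ≡ 0ℚ + γ * c * 0ℚ
    shuffle = solve-∀ ℚ-ring

even⊎odd : ∀ n → ∃ λ j → n ≡ j ℕ.+ j ⊎ n ≡ suc (j ℕ.+ j)
even⊎odd zero    = zero , inj₁ refl
even⊎odd (suc n) with even⊎odd n
... | j , inj₁ n≡2j   = j , inj₂ (cong suc n≡2j)
... | j , inj₂ n≡2j+1 = suc j , inj₁ (trans (cong suc n≡2j+1) (sym (double-suc j)))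

oddSeries-even : ∀ c j → oddSeries c (j ℕ.+ j) ≡ 0ℚ
oddSeries-even c zero    = refl
oddSeries-even c (suc j) rewrite ℕP.+-suc j j = oddSeries-even (λ i → c (suc i)) j

oddSeries-odd : ∀ c j → oddSeries c (suc (j ℕ.+ j)) ≡ c j
oddSeries-odd c zero    = refl
oddSeries-odd c (suc j) rewrite ℕP.+-suc j j = oddSeries-odd (λ i → c (suc i)) j

ODE-oddSeries : ∀ c γ β →
  (∀ j → (ℕ→ℚ (suc (suc (suc (j ℕ.+ j)))) * ℕ→ℚ (suc (suc (j ℕ.+ j)))) * c (suc j)
         + γ * (ℕ→ℚ (suc (j ℕ.+ j)) * ℕ→ℚ (suc (j ℕ.+ j))) * c j ≡ β * c j) →
  ODE (oddSeries c) γ β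
ODE-oddSeries c γ β rec M with even⊎odd M
... | j , inj₁ refl = begin
  a * z (suc (suc (j ℕ.+ j))) + g * z (j ℕ.+ j) ≡⟨ cong₂ (λ x y → a * x + g * y) z[2j+2]≡0 (oddSeries-even c j) ⟩
  a * 0ℚ + g * 0ℚ                               ≡⟨ vanish a g β ⟩
  β * 0ℚ                                        ≡⟨ cong (β *_) (sym (oddSeries-even c j)) ⟩
  β * z (j ℕ.+ j)                               ∎
  where
  open ≡-Reasoning
  z = oddSeries c
  a = ℕ→ℚ (suc (suc (j ℕ.+ j))) * ℕ→ℚ (suc (j ℕ.+ j))
  g = γ * (ℕ→ℚ (j ℕ.+ j) * ℕ→ℚ (j ℕ.+ j))
  z[2j+2]≡0 : z (suc (suc (j ℕ.+ j))) ≡ 0ℚ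
  z[2j+2]≡0 = trans (cong z (sym (double-suc j))) (oddSeries-even c (suc j))
  vanish : ∀ a g β → a * 0ℚ + g * 0ℚ ≡ β * 0ℚ
  vanish = solve-∀ ℚ-ring
... | j , inj₂ refl = begin
  a * z (suc (suc (suc (j ℕ.+ j)))) + g * z (suc (j ℕ.+ j)) ≡⟨ cong₂ (λ x y → a * x + g * y) z[2j+3]≡c (oddSeries-odd c j) ⟩
  a * c (suc j) + g * c j                                   ≡⟨ rec j ⟩
  β * c j                                                   ≡⟨ cong (β *_) (sym (oddSeries-odd c j)) ⟩
  β * z (suc (j ℕ.+ j))                                     ∎
  where
  open ≡-Reasoning
  z = oddSeries c
  a = ℕ→ℚ (suc (suc (suc (j ℕ.+ j)))) * ℕ→ℚ (suc (suc (j ℕ.+ j)))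
  g = γ * (ℕ→ℚ (suc (j ℕ.+ j)) * ℕ→ℚ (suc (j ℕ.+ j)))
  z[2j+3]≡c : z (suc (suc (suc (j ℕ.+ j)))) ≡ c (suc j)
  z[2j+3]≡c = trans (cong (z ∘ suc) (sym (double-suc j))) (oddSeries-odd c (suc j))

sinCoeff : ℕ → ℚ
sinCoeff j = (ℤ→ℚ (-1ℤ ℤ.^ j) * (ℤ.+ 1 / (4 ℕ.^ j)) {{m^n≢0 4 j}}) * inv! (suc (j ℕ.+ j))

ODE-twoSinHalf : ODE twoSinHalf 0ℚ (- (ℤ.+ 1 / 4))
ODE-twoSinHalf = ODE-oddSeries sinCoeff 0ℚ (- (ℤ.+ 1 / 4)) rec
  where
  rec : ∀ j → (ℕ→ℚ (suc (suc (suc (j ℕ.+ j)))) * ℕ→ℚ (suc (suc (j ℕ.+ j)))) * sinCoeff (suc j)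
              + 0ℚ * (ℕ→ℚ (suc (j ℕ.+ j)) * ℕ→ℚ (suc (j ℕ.+ j))) * sinCoeff j
              ≡ - (ℤ.+ 1 / 4) * sinCoeff j
  rec j = begin
    (a₃ * a₂) * sinCoeff (suc j) + 0ℚ * (a₁ * a₁) * sinCoeff j
      ≡⟨ cong (λ w → (a₃ * a₂) * w + 0ℚ * (a₁ * a₁) * sinCoeff j) unfold ⟩
    (a₃ * a₂) * ((- 1ℚ * s * (f * F)) * (r₃ * (r₂ * I))) + 0ℚ * (a₁ * a₁) * ((s * F) * I)
      ≡⟨ regroup a₃ a₂ s f F r₃ r₂ I a₁ ⟩
    (- f * ((s * F) * I)) * ((a₃ * r₃) * (a₂ * r₂))
      ≡⟨ cong₂ (λ x y → (- f * ((s * F) * I)) * (x * y))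
               (n*1/n≡1 (suc (suc (suc (j ℕ.+ j))))) (n*1/n≡1 (suc (suc (j ℕ.+ j)))) ⟩
    (- f * ((s * F) * I)) * (1ℚ * 1ℚ)
      ≡⟨ *-identityʳ _ ⟩
    - f * sinCoeff j ∎
    where
    open ≡-Reasoning
    a₃ = ℕ→ℚ (suc (suc (suc (j ℕ.+ j))))
    a₂ = ℕ→ℚ (suc (suc (j ℕ.+ j)))
    a₁ = ℕ→ℚ (suc (j ℕ.+ j))
    s  = ℤ→ℚ (-1ℤ ℤ.^ j)
    f  = ℤ.+ 1 / 4
    F  = (ℤ.+ 1 / (4 ℕ.^ j)) {{m^n≢0 4 j}}
    I  = inv! (suc (j ℕ.+ j))
    r₃ = ℤ.+ 1 / suc (suc (suc (j ℕ.+ j)))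
    r₂ = ℤ.+ 1 / suc (suc (j ℕ.+ j))
    unfold : sinCoeff (suc j) ≡ (- 1ℚ * s * (f * F)) * (r₃ * (r₂ * I))
    unfold = cong₂ _*_ (cong₂ _*_ (ℤ→ℚ-* -1ℤ (-1ℤ ℤ.^ j)) (1/[m*n]≡1/m*1/n 4 (4 ℕ.^ j) {{_}} {{m^n≢0 4 j}}))
                       (trans (cong inv! (cong suc (double-suc j)))
                              (trans (inv!-suc (suc (suc (j ℕ.+ j)))) (cong (r₃ *_) (inv!-suc (suc (j ℕ.+ j))))))
    regroup : ∀ a₃ a₂ s f F r₃ r₂ I a₁ →
      (a₃ * a₂) * ((- 1ℚ * s * (f * F)) * (r₃ * (r₂ * I))) + 0ℚ * (a₁ * a₁) * ((s * F) * I)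
      ≡ (- f * ((s * F) * I)) * ((a₃ * r₃) * (a₂ * r₂))
    regroup = solve-∀ ℚ-ring

arcsinhCoeff : ℕ → ℚ
arcsinhCoeff j = ℤ→ℚ (-1ℤ ℤ.^ j) * ℕ→ℚ ((j ℕ.+ j) !)
                   * ((ℤ.+ 1 / (4 ℕ.^ j)) {{m^n≢0 4 j}} * (inv! j * inv! j))
                   * (ℤ.+ 1 / suc (j ℕ.+ j))

ODE-arcsinh : ODE arcsinh 1ℚ 0ℚ
ODE-arcsinh = ODE-oddSeries arcsinhCoeff 1ℚ 0ℚ rec
  where
  rec : ∀ j → (ℕ→ℚ (suc (suc (suc (j ℕ.+ j)))) * ℕ→ℚ (suc (suc (j ℕ.+ j)))) * arcsinhCoeff (suc j)
              + 1ℚ * (ℕ→ℚ (suc (j ℕ.+ j)) * ℕ→ℚ (suc (j ℕ.+ j))) * arcsinhCoeff j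
              ≡ 0ℚ * arcsinhCoeff j
  rec j = begin
    (a₃ * a₂) * arcsinhCoeff (suc j) + 1ℚ * (a₁ * a₁) * arcsinhCoeff j
      ≡⟨ cong₂ (λ w a → (a₃ * a) * w + 1ℚ * (a₁ * a₁) * arcsinhCoeff j) unfold (ℕ→ℚ-double-suc j) ⟩
    (a₃ * (b + b)) * ((- 1ℚ * s) * ((b + b) * (a₁ * D)) * ((f * F) * ((rⱼ * I) * (rⱼ * I))) * r₃)
      + 1ℚ * (a₁ * a₁) * (s * D * (F * (I * I)) * r₁)
      ≡⟨ regroup a₃ b s a₁ D f F rⱼ I r₃ r₁ ⟩
    C * ((a₁ * r₁) + - ((a₃ * r₃) * ((b * rⱼ) * (b * rⱼ)) * (ℕ→ℚ 4 * f)))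
      ≡⟨ cong₂ (λ x y → C * (x + - y)) (n*1/n≡1 (suc (j ℕ.+ j)))
           (cong₂ (λ u v → u * v * (ℕ→ℚ 4 * f)) (n*1/n≡1 (suc (suc (suc (j ℕ.+ j)))))
                                                 (cong₂ _*_ (n*1/n≡1 (suc j)) (n*1/n≡1 (suc j)))) ⟩
    C * (1ℚ + - (1ℚ * (1ℚ * 1ℚ) * (ℕ→ℚ 4 * f)))
      ≡⟨ cong (λ y → C * (1ℚ + - (1ℚ * (1ℚ * 1ℚ) * y))) (n*1/n≡1 4) ⟩
    C * (1ℚ + - (1ℚ * (1ℚ * 1ℚ) * 1ℚ))
      ≡⟨ vanish C (arcsinhCoeff j) ⟩
    0ℚ * arcsinhCoeff j ∎
    where
    open ≡-Reasoning
    a₃ = ℕ→ℚ (suc (suc (suc (j ℕ.+ j))))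
    a₂ = ℕ→ℚ (suc (suc (j ℕ.+ j)))
    a₁ = ℕ→ℚ (suc (j ℕ.+ j))
    b  = ℕ→ℚ (suc j)
    s  = ℤ→ℚ (-1ℤ ℤ.^ j)
    D  = ℕ→ℚ ((j ℕ.+ j) !)
    f  = ℤ.+ 1 / 4
    F  = (ℤ.+ 1 / (4 ℕ.^ j)) {{m^n≢0 4 j}}
    I  = inv! j
    rⱼ = ℤ.+ 1 / suc j
    r₃ = ℤ.+ 1 / suc (suc (suc (j ℕ.+ j)))
    r₁ = ℤ.+ 1 / suc (j ℕ.+ j)
    C  = a₁ * (s * D * F * I * I)
    unfold : arcsinhCoeff (suc j) ≡ (- 1ℚ * s) * ((b + b) * (a₁ * D)) * ((f * F) * ((rⱼ * I) * (rⱼ * I))) * r₃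
    unfold = cong₂ _*_ (cong₂ _*_ (cong₂ _*_ (ℤ→ℚ-* -1ℤ (-1ℤ ℤ.^ j))
                                             (trans (ℕ→ℚ-double-suc! j) (cong (_* (a₁ * D)) (ℕ→ℚ-double-suc j))))
                                  (cong₂ _*_ (1/[m*n]≡1/m*1/n 4 (4 ℕ.^ j) {{_}} {{m^n≢0 4 j}})
                                             (cong₂ _*_ (inv!-suc j) (inv!-suc j))))
                       (cong (λ k → ℤ.+ 1 / suc k) (double-suc j))
    regroup : ∀ a₃ b s a₁ D f F rⱼ I r₃ r₁ →
      (a₃ * (b + b)) * ((- 1ℚ * s) * ((b + b) * (a₁ * D)) * ((f * F) * ((rⱼ * I) * (rⱼ * I))) * r₃)
        + 1ℚ * (a₁ * a₁) * (s * D * (F * (I * I)) * r₁)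
      ≡ (a₁ * (s * D * F * I * I)) * ((a₁ * r₁) + - ((a₃ * r₃) * ((b * rⱼ) * (b * rⱼ)) * (ℕ→ℚ 4 * f)))
    regroup = solve-∀ ℚ-ring
    vanish : ∀ x y → x * (1ℚ + - (1ℚ * (1ℚ * 1ℚ) * 1ℚ)) ≡ 0ℚ * y
    vanish = solve-∀ ℚ-ring

module Sin     = ODESolution twoSinHalf 0ℚ (- (ℤ.+ 1 / 4)) refl refl ODE-twoSinHalf
module Arcsinh = ODESolution arcsinh 1ℚ 0ℚ refl refl ODE-arcsinh

stirling1₂-above : ∀ n k → n < k → stirling1₂ n k ≡ 0
stirling1₂-above zero    (suc k) _         = refl
stirling1₂-above (suc n) (suc k) (s≤s n<k)
  rewrite stirling1₂-above n k n<k | stirling1₂-above n (suc k) (ℕP.m≤n⇒m≤1+n n<k) = ℕP.*-zeroʳ (n ℕ.* n)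

S₁ : ℕ → ℕ → ℚ
S₁ n k = ℕ→ℚ (stirling1₂ n k)

S₁-suc-suc : ∀ n k → S₁ (suc n) (suc k) ≡ S₁ n k + ℕ→ℚ (n ℕ.* n) * S₁ n (suc k)
S₁-suc-suc n k = trans (ℕ→ℚ-+ (stirling1₂ n k) _) (cong (S₁ n k +_) (ℕ→ℚ-* (n ℕ.* n) (stirling1₂ n (suc k))))

[-4]^ : ℕ → ℚ
[-4]^ k = ℤ→ℚ (-[1+ 3 ] ℤ.^ k)

Arcsinh-T≡[-4]^*S₁ : ∀ n j → Arcsinh.T n j ≡ [-4]^ (n ∸ j) * S₁ n j
Arcsinh-T≡[-4]^*S₁ zero    zero    = refl
Arcsinh-T≡[-4]^*S₁ zero    (suc j) = trans (Arcsinh.T-0 (suc j)) (sym (*-zeroʳ ([-4]^ 0)))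
Arcsinh-T≡[-4]^*S₁ (suc n) zero    = trans (Arcsinh.T-suc-0 n) (sym (*-zeroʳ ([-4]^ (suc n))))
Arcsinh-T≡[-4]^*S₁ (suc n) (suc j) = +-cancelʳ (g * A n (suc j)) _ _ (begin
  A (suc n) (suc j) + g * A n (suc j)
    ≡⟨ Arcsinh.T-rec n j ⟩
  A n j + 0ℚ * (a * a) * A n (suc j)
    ≡⟨ trans (cong (A n j +_) (trans (*-assoc 0ℚ (a * a) (A n (suc j))) (*-zeroˡ ((a * a) * A n (suc j))))) (+-identityʳ (A n j)) ⟩
  A n j
    ≡⟨ Arcsinh-T≡[-4]^*S₁ n j ⟩
  e * s₀
    ≡⟨ sym (trans (cong (e * s₀ +_) cross-terms) (+-identityʳ (e * s₀))) ⟩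
  e * s₀ + (e * (n² * s₁) + g * (e′ * s₁))
    ≡⟨ regroup e s₀ n² s₁ g (e′ * s₁) ⟩
  e * (s₀ + n² * s₁) + g * (e′ * s₁)
    ≡⟨ cong₂ (λ x y → e * x + g * y)
             (sym (S₁-suc-suc n j))
             (sym (Arcsinh-T≡[-4]^*S₁ n (suc j))) ⟩
  e * S₁ (suc n) (suc j) + g * A n (suc j) ∎)
  where
  open ≡-Reasoning
  A  = Arcsinh.T
  m  = ℕ→ℚ (n ℕ.+ n)
  g  = 1ℚ * (m * m)
  a  = ℕ→ℚ (suc (suc (j ℕ.+ j)))
  e  = [-4]^ (n ∸ j)
  e′ = [-4]^ (n ∸ suc j)
  s₀ = S₁ n j
  s₁ = S₁ n (suc j)
  n² = ℕ→ℚ (n ℕ.* n)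
  regroup : ∀ e s₀ n² s₁ g t → e * s₀ + (e * (n² * s₁) + g * t) ≡ e * (s₀ + n² * s₁) + g * t
  regroup = solve-∀ ℚ-ring
  cross-terms : e * (n² * s₁) + g * (e′ * s₁) ≡ 0ℚ
  cross-terms with ℕP.<-≤-connex (suc j) (suc n)
  ... | inj₁ (s≤s j<n) = begin
    e * (n² * s₁) + g * (e′ * s₁)
      ≡⟨ cong₂ (λ x y → x * (y * s₁) + g * (e′ * s₁))
               (trans (cong [-4]^ (ℕP.+-∸-assoc 1 j<n)) (ℤ→ℚ-* -[1+ 3 ] (-[1+ 3 ] ℤ.^ (n ∸ suc j))))
               (ℕ→ℚ-* n n) ⟩
    (- ℕ→ℚ 4 * e′) * ((ℕ→ℚ n * ℕ→ℚ n) * s₁) + 1ℚ * (m * m) * (e′ * s₁)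
      ≡⟨ cong (λ x → (- ℕ→ℚ 4 * e′) * ((ℕ→ℚ n * ℕ→ℚ n) * s₁) + 1ℚ * (x * x) * (e′ * s₁)) (ℕ→ℚ-+ n n) ⟩
    (- ℕ→ℚ 4 * e′) * ((ℕ→ℚ n * ℕ→ℚ n) * s₁) + 1ℚ * ((ℕ→ℚ n + ℕ→ℚ n) * (ℕ→ℚ n + ℕ→ℚ n)) * (e′ * s₁)
      ≡⟨ cancel e′ (ℕ→ℚ n) s₁ ⟩
    0ℚ ∎
    where
    cancel : ∀ e′ a s₁ → (- ℕ→ℚ 4 * e′) * ((a * a) * s₁) + 1ℚ * ((a + a) * (a + a)) * (e′ * s₁) ≡ 0ℚ
    cancel = solve-∀ ℚ-ring
  ... | inj₂ (s≤s n≤j) = begin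
    e * (n² * s₁) + g * (e′ * s₁)
      ≡⟨ cong (λ i → e * (n² * ℕ→ℚ i) + g * (e′ * ℕ→ℚ i)) (stirling1₂-above n (suc j) (s≤s n≤j)) ⟩
    e * (n² * 0ℚ) + g * (e′ * 0ℚ)
      ≡⟨ vanish e n² g e′ ⟩
    0ℚ ∎
    where
    vanish : ∀ e n² g e′ → e * (n² * 0ℚ) + g * (e′ * 0ℚ) ≡ 0ℚ
    vanish = solve-∀ ℚ-ring

Σ-S₁-suc : ∀ m (h : ℕ → ℚ) →
  Σ[0… suc m ] (λ l → S₁ (suc m) l * h l)
  ≡ Σ[0… m ] (λ l → S₁ m l * h (suc l)) + ℕ→ℚ (m ℕ.* m) * Σ[0… m ] (λ l → S₁ m (suc l) * h (suc l))
Σ-S₁-suc m h = begin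
  Σ[0… suc m ] (λ l → S₁ (suc m) l * h l)
    ≡⟨ Σ-suc m _ ⟩
  0ℚ * h 0 + Σ[0… m ] (λ l → S₁ (suc m) (suc l) * h (suc l))
    ≡⟨ trans (cong (_+ Σ′) (*-zeroˡ (h 0))) (+-identityˡ Σ′) ⟩
  Σ′
    ≡⟨ Σ-cong m (λ l _ → trans (cong (_* h (suc l)) (S₁-suc-suc m l)) (distrib (S₁ m l) n² (S₁ m (suc l)) (h (suc l)))) ⟩
  Σ[0… m ] (λ l → S₁ m l * h (suc l) + n² * (S₁ m (suc l) * h (suc l)))
    ≡⟨ Σ-distrib-+ m _ _ ⟩
  Σ[0… m ] (λ l → S₁ m l * h (suc l)) + Σ[0… m ] (λ l → n² * (S₁ m (suc l) * h (suc l)))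
    ≡⟨ cong (Σ[0… m ] (λ l → S₁ m l * h (suc l)) +_) (sym (*-distribˡ-Σ m n² _)) ⟩
  Σ[0… m ] (λ l → S₁ m l * h (suc l)) + n² * Σ[0… m ] (λ l → S₁ m (suc l) * h (suc l)) ∎
  where
  open ≡-Reasoning
  n² = ℕ→ℚ (m ℕ.* m)
  Σ′ = Σ[0… m ] (λ l → S₁ (suc m) (suc l) * h (suc l))
  distrib : ∀ a b c x → (a + b * c) * x ≡ a * x + b * (c * x)
  distrib = solve-∀ ℚ-ring

n²*S₁-n-0≡0 : ∀ n → ℕ→ℚ (n ℕ.* n) * S₁ n 0 ≡ 0ℚ
n²*S₁-n-0≡0 zero    = refl
n²*S₁-n-0≡0 (suc n) = *-zeroʳ (ℕ→ℚ (suc n ℕ.* suc n))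

n²*Σ-S₁-shift : ∀ m (h : ℕ → ℚ) →
  ℕ→ℚ (m ℕ.* m) * Σ[0… m ] (λ l → S₁ m (suc l) * h (suc l)) ≡ ℕ→ℚ (m ℕ.* m) * Σ[0… m ] (λ l → S₁ m l * h l)
n²*Σ-S₁-shift m h = begin
  n² * G                       ≡⟨ sym (trans (cong (_+ n² * G) (*-zeroˡ (h 0))) (+-identityˡ (n² * G))) ⟩
  0ℚ * h 0 + n² * G            ≡⟨ cong (λ x → x * h 0 + n² * G) (sym (n²*S₁-n-0≡0 m)) ⟩
  (n² * S₁ m 0) * h 0 + n² * G ≡⟨ factor n² (S₁ m 0) (h 0) G ⟩
  n² * (S₁ m 0 * h 0 + G)      ≡⟨ cong (n² *_) (sym (Σ-suc m _)) ⟩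
  n² * Σ[0… suc m ] (λ l → S₁ m l * h l)
    ≡⟨ cong (n² *_) (Σ-truncate m (suc m) _ (ℕP.n≤1+n m)
         (λ l m<l _ → trans (cong (λ i → ℕ→ℚ i * h l) (stirling1₂-above m l m<l)) (*-zeroˡ (h l)))) ⟩
  n² * Σ[0… m ] (λ l → S₁ m l * h l) ∎
  where
  open ≡-Reasoning
  n² = ℕ→ℚ (m ℕ.* m)
  G = Σ[0… m ] (λ l → S₁ m (suc l) * h (suc l))
  factor : ∀ a b t g → (a * b) * t + a * g ≡ a * (b * t + g)
  factor = solve-∀ ℚ-ring

Sin-T-rec : ∀ l j → Sin.T (suc l) (suc j) ≡ Sin.T l j + - ℕ→ℚ (suc j ℕ.* suc j) * Sin.T l (suc j)
Sin-T-rec l j = begin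
  Sin.T (suc l) (suc j)                                  ≡⟨ sym (drop-zero (Sin.T (suc l) (suc j)) c (Sin.T l (suc j))) ⟩
  Sin.T (suc l) (suc j) + 0ℚ * c * Sin.T l (suc j)       ≡⟨ Sin.T-rec l j ⟩
  Sin.T l j + - f * (a * a) * Sin.T l (suc j)            ≡⟨ cong (λ x → Sin.T l j + x * Sin.T l (suc j)) -f*a²≡-b² ⟩
  Sin.T l j + - ℕ→ℚ (suc j ℕ.* suc j) * Sin.T l (suc j)  ∎
  where
  open ≡-Reasoning
  c = ℕ→ℚ (l ℕ.+ l) * ℕ→ℚ (l ℕ.+ l)
  a = ℕ→ℚ (suc (suc (j ℕ.+ j)))
  b = ℕ→ℚ (suc j)
  f = ℤ.+ 1 / 4
  drop-zero : ∀ x c y → x + 0ℚ * c * y ≡ x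
  drop-zero = solve-∀ ℚ-ring
  regroup : ∀ b f → - f * ((b + b) * (b + b)) ≡ - (b * b) * (ℕ→ℚ 4 * f)
  regroup = solve-∀ ℚ-ring
  -f*a²≡-b² : - f * (a * a) ≡ - ℕ→ℚ (suc j ℕ.* suc j)
  -f*a²≡-b² = begin
    - f * (a * a)                ≡⟨ cong (λ x → - f * (x * x)) (ℕ→ℚ-double-suc j) ⟩
    - f * ((b + b) * (b + b))    ≡⟨ regroup b f ⟩
    - (b * b) * (ℕ→ℚ 4 * f)      ≡⟨ cong (- (b * b) *_) (n*1/n≡1 4) ⟩
    - (b * b) * 1ℚ               ≡⟨ *-identityʳ (- (b * b)) ⟩
    - (b * b)                    ≡⟨ cong -_ (sym (ℕ→ℚ-* (suc j) (suc j))) ⟩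
    - ℕ→ℚ (suc j ℕ.* suc j)      ∎

Sin-orthogonality : ∀ m j → Σ[0… m ] (λ l → S₁ m l * Sin.T l j) ≡ δ m j
Sin-orthogonality zero    j = trans (*-identityˡ (Sin.T 0 j)) (Sin.T-0 j)
Sin-orthogonality (suc m) j = begin
  Σ[0… suc m ] (λ l → S₁ (suc m) l * Sin.T l j)
    ≡⟨ Σ-S₁-suc m (λ l → Sin.T l j) ⟩
  Σ[0… m ] (λ l → S₁ m l * Sin.T (suc l) j) + n² * Σ[0… m ] (λ l → S₁ m (suc l) * Sin.T (suc l) j)
    ≡⟨ cong (Σ[0… m ] (λ l → S₁ m l * Sin.T (suc l) j) +_)
            (trans (n²*Σ-S₁-shift m (λ l → Sin.T l j)) (cong (n² *_) (Sin-orthogonality m j))) ⟩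
  Σ[0… m ] (λ l → S₁ m l * Sin.T (suc l) j) + n² * δ m j
    ≡⟨ shifted j ⟩
  δ (suc m) j ∎
  where
  open ≡-Reasoning
  n² = ℕ→ℚ (m ℕ.* m)
  shifted : ∀ j → Σ[0… m ] (λ l → S₁ m l * Sin.T (suc l) j) + n² * δ m j ≡ δ (suc m) j
  shifted zero = begin
    Σ[0… m ] (λ l → S₁ m l * Sin.T (suc l) 0) + n² * δ m 0
      ≡⟨ cong₂ _+_ (Σ-zero m (λ l _ → trans (cong (S₁ m l *_) (Sin.T-suc-0 l)) (*-zeroʳ (S₁ m l))))
                   (*-δ-swap (λ k → ℕ→ℚ (k ℕ.* k)) m 0) ⟩
    0ℚ + 0ℚ * δ m 0
      ≡⟨ trans (+-identityˡ (0ℚ * δ m 0)) (*-zeroˡ (δ m 0)) ⟩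
    0ℚ ∎
  shifted (suc j) = begin
    Σ[0… m ] (λ l → S₁ m l * Sin.T (suc l) (suc j)) + n² * δ m (suc j)
      ≡⟨ cong₂ _+_ (Σ-cong m (λ l _ → trans (cong (S₁ m l *_) (Sin-T-rec l j)) (distrib (S₁ m l) _ c _)))
                   (*-δ-swap (λ k → ℕ→ℚ (k ℕ.* k)) m (suc j)) ⟩
    Σ[0… m ] (λ l → S₁ m l * Sin.T l j + - c * (S₁ m l * Sin.T l (suc j))) + c * δ m (suc j)
      ≡⟨ cong (_+ c * δ m (suc j)) (trans (Σ-distrib-+ m _ _) (cong (Σ[0… m ] (λ l → S₁ m l * Sin.T l j) +_)
                                                                 (sym (*-distribˡ-Σ m (- c) _)))) ⟩
    (Σ[0… m ] (λ l → S₁ m l * Sin.T l j) + - c * Σ[0… m ] (λ l → S₁ m l * Sin.T l (suc j))) + c * δ m (suc j)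
      ≡⟨ cong₂ (λ x y → (x + - c * y) + c * δ m (suc j)) (Sin-orthogonality m j) (Sin-orthogonality m (suc j)) ⟩
    (δ m j + - c * δ m (suc j)) + c * δ m (suc j)
      ≡⟨ cancel (δ m j) c (δ m (suc j)) ⟩
    δ m j ∎
    where
    c = ℕ→ℚ (suc j ℕ.* suc j)
    distrib : ∀ s t c u → s * (t + - c * u) ≡ s * t + - c * (s * u)
    distrib = solve-∀ ℚ-ring
    cancel : ∀ a c d → (a + - c * d) + c * d ≡ a
    cancel = solve-∀ ℚ-ring

Σ₁-S₁*Sin-T : ∀ m j → 1 ≤ m → Σ[1… m ] (λ l → S₁ m l * Sin.T l j) ≡ δ m j
Σ₁-S₁*Sin-T (suc m) j _ = trans (sym (Σ≡Σ₁ (suc m) _ (*-zeroˡ (Sin.T 0 j)))) (Sin-orthogonality (suc m) j)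

2*n≡n+n : ∀ n → 2 ℕ.* n ≡ n ℕ.+ n
2*n≡n+n n = cong (n ℕ.+_) (ℕP.+-identityʳ n)

module _ (k : ℤ) where

  a : ℕ → ℚ
  a j = oddPow⁻ j k

  E : ℕ → ℚ
  E j = ℕ→ℚ ((j ℕ.+ j) !) * a j

  polyCauchy₂-expansion : ∀ n → polyCauchy₂ (2 ℕ.* n) k ≡ Σ[0… n ] (λ j → Arcsinh.T n j * a j)
  polyCauchy₂-expansion n = begin
    polyCauchy₂ (2 ℕ.* n) k
      ≡⟨ cong (λ N → polyCauchy₂ N k) (2*n≡n+n n) ⟩
    ℕ→ℚ ((n ℕ.+ n) !) * Σ[0… n ℕ.+ n ] (λ j → (arcsinh ^ₛ (j ℕ.+ j)) (n ℕ.+ n) * inv! (j ℕ.+ j) * a j)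
      ≡⟨ *-distribˡ-Σ (n ℕ.+ n) (ℕ→ℚ ((n ℕ.+ n) !)) _ ⟩
    Σ[0… n ℕ.+ n ] (λ j → ℕ→ℚ ((n ℕ.+ n) !) * ((arcsinh ^ₛ (j ℕ.+ j)) (n ℕ.+ n) * inv! (j ℕ.+ j) * a j))
      ≡⟨ Σ-cong (n ℕ.+ n) (λ j _ →
           regroup (ℕ→ℚ ((n ℕ.+ n) !)) ((arcsinh ^ₛ (j ℕ.+ j)) (n ℕ.+ n)) (inv! (j ℕ.+ j)) (a j)) ⟩
    Σ[0… n ℕ.+ n ] (λ j → Arcsinh.T n j * a j)
      ≡⟨ Σ-truncate n (n ℕ.+ n) _ (ℕP.m≤m+n n n)
           (λ j n<j _ → trans (cong (_* a j) (Arcsinh.T-above n j n<j)) (*-zeroˡ (a j))) ⟩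
    Σ[0… n ] (λ j → Arcsinh.T n j * a j) ∎
    where
    open ≡-Reasoning
    regroup : ∀ F S I x → F * (S * I * x) ≡ ((F * S) * I) * x
    regroup = solve-∀ ℚ-ring

  polyBernoulli₂-expansion : ∀ n l → l ≤ n → polyBernoulli₂ (2 ℕ.* l) k ≡ Σ[0… n ] (λ j → Sin.T l j * E j)
  polyBernoulli₂-expansion n l l≤n = begin
    polyBernoulli₂ (2 ℕ.* l) k
      ≡⟨ cong (λ N → polyBernoulli₂ N k) (2*n≡n+n l) ⟩
    F * Σ[0… l ℕ.+ l ] (λ j → Z j * a j)
      ≡⟨ *-distribˡ-Σ (l ℕ.+ l) F _ ⟩
    Σ[0… l ℕ.+ l ] (λ j → F * (Z j * a j))
      ≡⟨ Σ-cong (l ℕ.+ l) (λ j _ → term j) ⟩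
    Σ[0… l ℕ.+ l ] (λ j → Sin.T l j * E j)
      ≡⟨ Σ-truncate l (l ℕ.+ l) _ (ℕP.m≤m+n l l) vanishing ⟩
    Σ[0… l ] (λ j → Sin.T l j * E j)
      ≡⟨ sym (Σ-truncate l n _ l≤n vanishing) ⟩
    Σ[0… n ] (λ j → Sin.T l j * E j) ∎
    where
    open ≡-Reasoning
    F = ℕ→ℚ ((l ℕ.+ l) !)
    Z : ℕ → ℚ
    Z j = (twoSinHalf ^ₛ (j ℕ.+ j)) (l ℕ.+ l)
    regroup : ∀ F S I D x → ((F * S) * I) * (D * x) ≡ F * (S * x) * (I * D)
    regroup = solve-∀ ℚ-ring
    term : ∀ j → F * (Z j * a j) ≡ Sin.T l j * E j
    term j = sym (begin
      ((F * Z j) * inv! (j ℕ.+ j)) * E j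
        ≡⟨ regroup F (Z j) (inv! (j ℕ.+ j)) (ℕ→ℚ ((j ℕ.+ j) !)) (a j) ⟩
      F * (Z j * a j) * (inv! (j ℕ.+ j) * ℕ→ℚ ((j ℕ.+ j) !))
        ≡⟨ cong (F * (Z j * a j) *_) (inv!*n!≡1 (j ℕ.+ j)) ⟩
      F * (Z j * a j) * 1ℚ
        ≡⟨ *-identityʳ _ ⟩
      F * (Z j * a j) ∎)
    vanishing : ∀ {N} j → l < j → j ≤ N → Sin.T l j * E j ≡ 0ℚ
    vanishing j l<j _ = trans (cong (_* E j) (Sin.T-above l j l<j)) (*-zeroˡ (E j))

  Σ₁-S₁*polyBernoulli₂ : ∀ n m c → 1 ≤ m → m ≤ n →
    Σ[1… m ] (λ l → c * S₁ m l * polyBernoulli₂ (2 ℕ.* l) k) ≡ c * E m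
  Σ₁-S₁*polyBernoulli₂ n m c 1≤m m≤n = begin
    Σ[1… m ] (λ l → c * S₁ m l * polyBernoulli₂ (2 ℕ.* l) k)
      ≡⟨ Σ₁-cong m (λ l _ l≤m → expand l (ℕP.≤-trans l≤m m≤n)) ⟩
    Σ[1… m ] (λ l → Σ[0… n ] (λ j → (c * E j) * (S₁ m l * Sin.T l j)))
      ≡⟨ Σ₁-Σ-comm m n _ ⟩
    Σ[0… n ] (λ j → Σ[1… m ] (λ l → (c * E j) * (S₁ m l * Sin.T l j)))
      ≡⟨ Σ-cong n (λ j _ → trans (sym (*-distribˡ-Σ₁ m (c * E j) _))
                          (trans (cong ((c * E j) *_) (Σ₁-S₁*Sin-T m j 1≤m)) (*-comm (c * E j) (δ m j)))) ⟩
    Σ[0… n ] (λ j → δ m j * (c * E j))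
      ≡⟨ Σ-δ n m (λ j → c * E j) m≤n ⟩
    c * E m ∎
    where
    open ≡-Reasoning
    regroup : ∀ c s t e → c * s * (t * e) ≡ (c * e) * (s * t)
    regroup = solve-∀ ℚ-ring
    expand : ∀ l → l ≤ n → c * S₁ m l * polyBernoulli₂ (2 ℕ.* l) k
                         ≡ Σ[0… n ] (λ j → (c * E j) * (S₁ m l * Sin.T l j))
    expand l l≤n = trans (cong (c * S₁ m l *_) (polyBernoulli₂-expansion n l l≤n))
                         (trans (*-distribˡ-Σ n (c * S₁ m l) _)
                                (Σ-cong n (λ j _ → regroup c (S₁ m l) (Sin.T l j) (E j))))

  [-4]^*inv!*S₁*E≡Arcsinh-T*a : ∀ n m → [-4]^ (n ∸ m) * inv! (2 ℕ.* m) * S₁ n m * E m ≡ Arcsinh.T n m * a m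
  [-4]^*inv!*S₁*E≡Arcsinh-T*a n m = begin
    e * inv! (2 ℕ.* m) * s * (D * a m)   ≡⟨ cong (λ i → e * inv! i * s * (D * a m)) (2*n≡n+n m) ⟩
    e * I * s * (D * a m)                ≡⟨ regroup e I s D (a m) ⟩
    (e * s) * a m * (I * D)              ≡⟨ cong ((e * s) * a m *_) (inv!*n!≡1 (m ℕ.+ m)) ⟩
    (e * s) * a m * 1ℚ                   ≡⟨ *-identityʳ ((e * s) * a m) ⟩
    (e * s) * a m                        ≡⟨ cong (_* a m) (sym (Arcsinh-T≡[-4]^*S₁ n m)) ⟩
    Arcsinh.T n m * a m                  ∎
    where
    open ≡-Reasoning
    e = [-4]^ (n ∸ m)
    s = S₁ n m
    I = inv! (m ℕ.+ m)
    D = ℕ→ℚ ((m ℕ.+ m) !)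
    regroup : ∀ e I s D x → e * I * s * (D * x) ≡ (e * s) * x * (I * D)
    regroup = solve-∀ ℚ-ring

theorem7 : (n : ℕ) → 1 ℕ.≤ n → (k : ℤ) →
    polyCauchy₂ (2 ℕ.* n) k ≡
      Σ[1… n ] (λ m → Σ[1… m ] (λ l →
        ℤ→ℚ (-[1+ 3 ] ℤ.^ (n ∸ m)) * inv! (2 ℕ.* m)
          * ℕ→ℚ (stirling1₂ n m) * ℕ→ℚ (stirling1₂ m l)
          * polyBernoulli₂ (2 ℕ.* l) k))
theorem7 n 1≤n k = begin
  polyCauchy₂ (2 ℕ.* n) k
    ≡⟨ polyCauchy₂-expansion k n ⟩
  Σ[0… n ] (λ m → Arcsinh.T n m * a k m)
    ≡⟨ Σ≡Σ₁ n _ (Arcsinh-T-n-0*a 1≤n) ⟩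
  Σ[1… n ] (λ m → Arcsinh.T n m * a k m)
    ≡⟨ Σ₁-cong n (λ m _ _ → sym ([-4]^*inv!*S₁*E≡Arcsinh-T*a k n m)) ⟩
  Σ[1… n ] (λ m → c m * E k m)
    ≡⟨ Σ₁-cong n (λ m 1≤m m≤n → sym (Σ₁-S₁*polyBernoulli₂ k n m (c m) 1≤m m≤n)) ⟩
  Σ[1… n ] (λ m → Σ[1… m ] (λ l → c m * S₁ m l * polyBernoulli₂ (2 ℕ.* l) k)) ∎
  where
  open ≡-Reasoning
  c : ℕ → ℚ
  c m = [-4]^ (n ∸ m) * inv! (2 ℕ.* m) * S₁ n m
  Arcsinh-T-n-0*a : ∀ {n} → 1 ≤ n → Arcsinh.T n 0 * a k 0 ≡ 0ℚ
  Arcsinh-T-n-0*a {suc n} _ = trans (cong (_* a k 0) (Arcsinh.T-suc-0 n)) (*-zeroˡ (a k 0))
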